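{- Let $k\geqslant1$, $a_0,\ldots,a_k\in\mathbb Z$, $n_0,\ldots,n_k\in\mathbb Z^+$, and put $m=\lfloor\sum_{s=1}^k1/n_s\rfloor$. Suppose that for every $x\in\mathbb Z$, $|\{0\leqslant s\leqslant k: x\equiv a_s\pmod{n_s}\}|>m$. Then $$\Big|\Big\{I\subseteq[1,k]:\ \sum_{s\in I}\frac1{n_s}=\frac{a}{n_0}\Big\}\Big|\geqslant\binom{m}{\lfloor a/n_0\rfloor}\quad\text{for all } a\in\mathbb N=\{0,1,2,\ldots\}.$$ In particular, if $a_1,\ldots,a_k\in\mathbb Z$, $n_1,\ldots,n_k\in\mathbb Z^+$ and $\min_{x\in\mathbb Z}|\{1\leqslant s\leqslant k: x\equiv a_s\pmod{n_s}\}|=\lfloor\sum_{s=1}^k1/n_s\rfloor=:M$, then $$\Big|\Big\{I\subseteq[1,k]:\ \sum_{s\in I}\frac1{n_s}=n\Big\}\Big|\geqslant\binom{M}{n}\quad\text{for each } n\in\mathbb N.$$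
   Context: $[1,k]=\{1,2,\ldots,k\}$; subsets $I$ include the empty set (with empty sum $0$). $\lfloor\cdot\rfloor$ is the integer part; $\binom{m}{j}=0$ if $j>m$. -}

module Defs where

open import Data.Nat as ℕ using (ℕ; zero; suc; NonZero)
open import Data.Integer as ℤ using (ℤ; +_; _-_)
open import Data.Integer.Divisibility.Signed using (_∣_; _∣?_)
open import Data.Rational as ℚ using (ℚ; 0ℚ)
open import Data.Fin using (Fin)
open import Data.Fin.Subset using (Subset; inside; outside)
open import Data.Fin.Subset.Properties using (_∈?_)
open import Data.Vec using (_∷_; [])
open import Data.List using (List; []; _∷_; map; filter; foldr; length; _++_; allFin)
open import Relation.Unary using (Decidable)

sumℚ : List ℚ → ℚ
sumℚ = foldr ℚ._+_ 0ℚ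

-- The list of all subsets of Fin k (each exactly once), i.e. all subsets of [1,k].
allSubsets : (k : ℕ) → List (Subset k)
allSubsets zero    = [] ∷ []
allSubsets (suc k) = map (inside ∷_) (allSubsets k) ++ map (outside ∷_) (allSubsets k)

countSubsets : (k : ℕ) {P : Subset k → Set} → Decidable P → ℕ
countSubsets k P? = length (filter P? (allSubsets k))

recip : (n : ℕ) → NonZero n → ℚ
recip n nz = (ℤ.1ℤ ℚ./ n) {{nz}}

recipSum : {k : ℕ} (n : Fin k → ℕ) → ((s : Fin k) → NonZero (n s)) → Subset k → ℚ
recipSum {k} n nz I = sumℚ (map (λ s → recip (n s) (nz s)) (filter (_∈? I) (allFin k)))

totalRecip : {k : ℕ} (n : Fin k → ℕ) → ((s : Fin k) → NonZero (n s)) → ℚ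
totalRecip {k} n nz = sumℚ (map (λ s → recip (n s) (nz s)) (allFin k))

coverCount : {r : ℕ} (a : Fin r → ℤ) (n : Fin r → ℕ) → ℤ → ℕ
coverCount {r} a n x = length (filter (λ s → (+ n s) ∣? (x - a s)) (allFin r))

-- Let N be a common multiple of the n_s, d_s = N/n_s, ζ a primitive N-th root of unity and Y = z^{1/N}. Then
-- T = ∏_{s≥1} (1 − ζ^{a_s d_s} Y^{d_s}) = ∑_I ±ζ^{…} Y^{N·∑_{s∈I} 1/n_s}, so the coefficient of Y^k in T is a sum of
-- #{I : N·∑_{s∈I} 1/n_s = k} roots of unity. Since 1 − ζ^{ad} Y^d = ∏_{i<d} (1 − ζ^{a+in} Y), T is the product of
-- the factors 1 − ζ^z Y over the residues z (mod N) of the classes a_s (mod n_s), s ≥ 1. By the covering hypothesis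
-- every residue occurs there at least m times, and m + 1 times once class 0 is added; hence T = (1 − Y^N)^m R with
-- deg R < N (as ∑_{s≥1} 1/n_s < m + 1), and (1 − ζ^{a_0 d_0} Y^{d_0}) R = (1 − Y^N) Q with deg Q < d_0. Comparing
-- coefficients below degree N gives R_{r d_0} = ζ^{r a_0 d_0} for r < n_0, so the coefficient of Y^{(j n_0 + r) d_0}
-- in T is ±C(m,j) ζ^{r a_0 d_0}.
-- To stay inside ℤ, ℤ[ζ] is modelled by the group ring ℤ[ℤ/N] = ℤ[u]: two elements agree in ℤ[ζ] when their products
-- with E = ∏_{p ∣ N prime} (1 − u^{N/p}) agree. The coefficients of E are 1 at u^0 and in {−1, 0, 1} elsewhere, so a
-- single coefficient of E·T bounds the count from below by C(m,j).

module Submission where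

open import Data.Nat as ℕ using (ℕ; zero; suc; NonZero; z≤n; s≤s; _∸_; _/_; _%_; _≤_; _<_; _>_; _≥_)
import Data.Nat.DivMod as ℕDM
import Data.Nat.Properties as ℕP
open import Data.Integer as ℤ using (ℤ; +_; 0ℤ; 1ℤ; -1ℤ; _+_; _*_; _-_; -_)
import Data.Integer.Properties as ℤP
open import Data.Integer.Divisibility.Signed
  using (_∣_; _∣?_; divides; ∣-refl; ∣m∣n⇒∣m+n; ∣m∣n⇒∣m-n; ∣n⇒∣m*n; ∣m⇒∣-m; ∣⇒∣ᵤ; ∣ᵤ⇒∣)
open import Data.Integer.DivMod using (_%ℕ_; _/ℕ_; n%ℕd<d; a≡a%ℕn+[a/ℕn]*n; div-pos-is-/ℕ; n<s[n/ℕd]*d)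
open import Data.Integer.Tactic.RingSolver using (solve-∀)
import Data.Nat.Tactic.RingSolver as ℕSolver
open import Data.List using (List; []; _∷_; _++_; map; length; replicate; filter; allFin; tabulate)
open import Data.Nat.ListAction using (sum; product)
open import Data.Nat.ListAction.Properties using (product≢0; ∈⇒∣product)
open import Data.List.Membership.Propositional.Properties using (∈-map⁺; ∈-allFin)
open import Data.Rational as ℚ using (ℚ; toℚᵘ; floor)
open import Data.Rational.Properties using (_≟_)
import Data.Rational.Properties as ℚP
open import Data.Rational.Unnormalised as ℚᵘ using (ℚᵘ; mkℚᵘ; *≡*; _≃_)
import Data.Rational.Unnormalised.Properties as ℚᵘP
open import Defs
open import Data.Fin using (Fin; zero; suc)
open import Data.Fin.Subset using (Subset; inside; outside)
open import Data.Fin.Subset.Properties using (_∈?_)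
open import Data.Vec using (_∷_; [])
open import Data.Bool using (true; false)
open import Relation.Unary using (Decidable)
open import Data.Nat.Combinatorics using (_C_; nCk+nC[k+1]≡[n+1]C[k+1])
import Data.List.Properties as ListP
open import Data.List.Relation.Unary.All as All using (All; []; _∷_)
import Data.List.Relation.Unary.All.Properties as AllP
open import Data.Product using (Σ-syntax; _×_; _,_; ∃)
open import Data.Sum using (_⊎_; inj₁; inj₂)
open import Data.Empty using (⊥; ⊥-elim)
open import Function using (_∘_)
open import Relation.Nullary using (yes; no; ¬_; does)
open import Relation.Binary.Definitions using (tri<; tri≈; tri>)
open import Relation.Binary.PropositionalEquality
open import Algebra.Structures using (IsCommutativeMonoid)
open import Algebra.Bundles using (CommutativeSemigroup)
import Algebra.Properties.CommutativeSemigroup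
open import Relation.Binary.Bundles using (Setoid)
import Data.Nat.Divisibility as ℕD
open import Data.Nat.GCD using (gcd; gcd-GCD; gcd[m,n]∣m; gcd[m,n]∣n; module Bézout)
open import Data.Nat.Primality using (Prime; prime?; euclidsLemma; prime⇒nonZero; prime⇒nonTrivial; prime[2])
open import Data.Nat.Primality.Factorisation using (factorise)

∑ : {A : Set} → (A → ℤ) → List A → ℤ
∑ f []       = 0ℤ
∑ f (a ∷ as) = f a + ∑ f as

∑-++ : ∀ {A : Set} (f : A → ℤ) xs ys → ∑ f (xs ++ ys) ≡ ∑ f xs + ∑ f ys
∑-++ f []       ys = sym (ℤP.+-identityˡ _)
∑-++ f (x ∷ xs) ys = trans (cong (_+_ (f x)) (∑-++ f xs ys)) (sym (ℤP.+-assoc (f x) _ _))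

∑-cong : ∀ {A : Set} {f g : A → ℤ} → (∀ a → f a ≡ g a) → ∀ xs → ∑ f xs ≡ ∑ g xs
∑-cong f≡g []       = refl
∑-cong f≡g (x ∷ xs) = cong₂ _+_ (f≡g x) (∑-cong f≡g xs)

∑-map : ∀ {A B : Set} (f : B → ℤ) (h : A → B) xs → ∑ f (map h xs) ≡ ∑ (f ∘ h) xs
∑-map f h []       = refl
∑-map f h (x ∷ xs) = cong (_+_ (f (h x))) (∑-map f h xs)

∑-zero : ∀ {A : Set} {f : A → ℤ} → (∀ a → f a ≡ 0ℤ) → ∀ xs → ∑ f xs ≡ 0ℤ
∑-zero f≡0 []       = refl
∑-zero f≡0 (x ∷ xs) = cong₂ _+_ (f≡0 x) (∑-zero f≡0 xs)

∑-+ : ∀ {A : Set} (f g : A → ℤ) xs → ∑ (λ a → f a + g a) xs ≡ ∑ f xs + ∑ g xs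
∑-+ f g []       = refl
∑-+ f g (x ∷ xs) = trans (cong (_+_ (f x + g x)) (∑-+ f g xs)) (interchange (f x) (g x) _ _)
  where
  interchange : ∀ a b c d → (a + b) + (c + d) ≡ (a + c) + (b + d)
  interchange = solve-∀

∑-*ˡ : ∀ {A : Set} c (f : A → ℤ) xs → ∑ (λ a → c * f a) xs ≡ c * ∑ f xs
∑-*ˡ c f []       = sym (ℤP.*-zeroʳ c)
∑-*ˡ c f (x ∷ xs) = trans (cong (_+_ (c * f x)) (∑-*ˡ c f xs)) (sym (ℤP.*-distribˡ-+ c (f x) _))

∑-swap : ∀ {A B : Set} (F : A → B → ℤ) xs ys →
         ∑ (λ a → ∑ (F a) ys) xs ≡ ∑ (λ b → ∑ (λ a → F a b) xs) ys
∑-swap F []       ys = sym (∑-zero (λ _ → refl) ys)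
∑-swap F (x ∷ xs) ys = trans (cong (_+_ (∑ (F x) ys)) (∑-swap F xs ys)) (sym (∑-+ (F x) _ ys))

allFin-suc : ∀ r → allFin (suc r) ≡ zero ∷ map suc (allFin r)
allFin-suc r = cong (zero ∷_) (sym (ListP.map-tabulate (λ i → i) suc))

sum-map-allFin-suc : ∀ {r} (f : Fin (suc r) → ℕ) → sum (map f (allFin (suc r))) ≡ f zero ℕ.+ sum (map (f ∘ suc) (allFin r))
sum-map-allFin-suc {r} f = trans (cong (λ xs → sum (map f xs)) (allFin-suc r)) (cong (λ xs → f zero ℕ.+ sum xs) (sym (ListP.map-∘ (allFin r))))

filter-∈?-map-suc : ∀ {r} b (I : Subset r) xs → filter (_∈? (b ∷ I)) (map suc xs) ≡ map suc (filter (_∈? I) xs)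
filter-∈?-map-suc b I []       = refl
filter-∈?-map-suc b I (i ∷ xs) with does (i ∈? I)
... | true  = cong (suc i ∷_) (filter-∈?-map-suc b I xs)
... | false = filter-∈?-map-suc b I xs

filter-map : ∀ {A B : Set} {P : B → Set} (P? : Decidable P) (f : A → B) xs → filter P? (map f xs) ≡ map f (filter (P? ∘ f) xs)
filter-map P? f []       = refl
filter-map P? f (x ∷ xs) with does (P? (f x))
... | true  = cong (f x ∷_) (filter-map P? f xs)
... | false = filter-map P? f xs

count≤sum : ∀ {A : Set} {P : A → Set} (P? : Decidable P) (F : A → ℕ) → (∀ x → P x → 1 ℕ.≤ F x) →
            ∀ xs → length (filter P? xs) ℕ.≤ sum (map F xs)
count≤sum P? F P⇒1≤F []       = z≤n
count≤sum P? F P⇒1≤F (x ∷ xs) with P? x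
... | yes Px = ℕP.+-mono-≤ (P⇒1≤F x Px) (count≤sum P? F P⇒1≤F xs)
... | no  _  = ℕP.≤-trans (count≤sum P? F P⇒1≤F xs) (ℕP.m≤n+m _ (F x))

progression : ℤ → ℕ → ℕ → List ℤ
progression b n zero    = []
progression b n (suc d) = b ∷ progression (b + + n) n d

length-progression : ∀ b n d → length (progression b n d) ≡ d
length-progression b n zero    = refl
length-progression b n (suc d) = cong suc (length-progression (b + + n) n d)

progression-+ : ∀ b n d → map (_+ + n) (progression b n d) ≡ progression (b + + n) n d
progression-+ b n zero    = refl
progression-+ b n (suc d) = cong (b + + n ∷_) (progression-+ (b + + n) n d)

progression-step : ∀ b n i → (b + + n) + + (n ℕ.* i) ≡ b + + (n ℕ.* suc i)
progression-step b n i rewrite ℕP.*-suc n i | ℤP.pos-+ n (n ℕ.* i) = ℤP.+-assoc b (+ n) (+ (n ℕ.* i))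

progression-last : ∀ b n d → progression b n (suc d) ≡ progression b n d ++ (b + + (n ℕ.* d)) ∷ []
progression-last b n zero    = cong (λ z → z ∷ []) (sym (trans (cong (λ k → b + + k) (ℕP.*-zeroʳ n)) (ℤP.+-identityʳ b)))
progression-last b n (suc d) =
  cong (b ∷_) (trans (progression-last (b + + n) n d) (cong (λ z → progression (b + + n) n d ++ z ∷ []) (progression-step b n d)))

progressions : ∀ {r} → (Fin r → ℤ) → (Fin r → ℕ) → (Fin r → ℕ) → List ℤ
progressions {zero}  b n d = []
progressions {suc r} b n d = progression (b zero) (n zero) (d zero) ++ progressions (b ∘ suc) (n ∘ suc) (d ∘ suc)

length-progressions : ∀ {r} b n (d : Fin r → ℕ) → length (progressions b n d) ≡ sum (map d (allFin r))
length-progressions {zero}  b n d = refl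
length-progressions {suc r} b n d =
  trans (ListP.length-++ (progression (b zero) (n zero) (d zero)))
        (trans (cong₂ ℕ._+_ (length-progression (b zero) (n zero) (d zero)) (length-progressions (b ∘ suc) (n ∘ suc) (d ∘ suc)))
               (sym (sum-map-allFin-suc d)))

triangular : ℕ → ℕ
triangular zero    = 0
triangular (suc d) = d ℕ.+ triangular d

∑-progression : ∀ b n d → ∑ (λ y → y) (progression b n d) ≡ b * + d + + (n ℕ.* triangular d)
∑-progression b n zero    = sym (cong₂ (λ z k → z + + k) (ℤP.*-zeroʳ b) (ℕP.*-zeroʳ n))
∑-progression b n (suc d) = begin
  b + ∑ (λ y → y) (progression (b + + n) n d)          ≡⟨ cong (_+_ b) (∑-progression (b + + n) n d) ⟩
  b + ((b + + n) * + d + + (n ℕ.* triangular d))        ≡⟨ cong (λ z → b + ((b + + n) * + d + z)) (ℤP.pos-* n (triangular d)) ⟩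
  b + ((b + + n) * + d + + n * + triangular d)          ≡⟨ regroup b (+ n) (+ d) (+ triangular d) ⟩
  b * (1ℤ + + d) + + n * (+ d + + triangular d)         ≡⟨ cong (λ z → b * (1ℤ + + d) + z) (sym (trans (ℤP.pos-* n _) (cong (+ n *_) (ℤP.pos-+ d _)))) ⟩
  b * + suc d + + (n ℕ.* (d ℕ.+ triangular d))          ∎
  where
  open ≡-Reasoning
  regroup : ∀ b n d t → b + ((b + n) * d + n * t) ≡ b * (1ℤ + d) + n * (d + t)
  regroup = solve-∀

triangular-parity : ∀ d → (Σ[ j ∈ ℕ ] (d ≡ suc (j ℕ.+ j) × triangular d ≡ d ℕ.* j))
                        ⊎ (Σ[ j ∈ ℕ ] (d ≡ j ℕ.+ j × triangular d ℕ.+ j ≡ d ℕ.* j))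
triangular-parity zero = inj₂ (0 , refl , refl)
triangular-parity (suc d) with triangular-parity d
... | inj₂ (j , refl , T+j≡d*j) = inj₁ (j , refl , ℕP.+-cancelʳ-≡ j _ _ (begin
  (j ℕ.+ j) ℕ.+ triangular (j ℕ.+ j) ℕ.+ j     ≡⟨ ℕP.+-assoc (j ℕ.+ j) _ j ⟩
  (j ℕ.+ j) ℕ.+ (triangular (j ℕ.+ j) ℕ.+ j)   ≡⟨ cong ((j ℕ.+ j) ℕ.+_) T+j≡d*j ⟩
  (j ℕ.+ j) ℕ.+ (j ℕ.+ j) ℕ.* j                ≡⟨ regroup j ⟩
  suc (j ℕ.+ j) ℕ.* j ℕ.+ j                    ∎))
  where
  open ≡-Reasoning
  regroup : ∀ j → (j ℕ.+ j) ℕ.+ (j ℕ.+ j) ℕ.* j ≡ suc (j ℕ.+ j) ℕ.* j ℕ.+ j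
  regroup = ℕSolver.solve-∀
... | inj₁ (j , refl , T≡d*j) =
  inj₂ (suc j , cong suc (sym (ℕP.+-suc j j)) , trans (cong (λ t → suc (j ℕ.+ j) ℕ.+ t ℕ.+ suc j) T≡d*j) (regroup j))
  where
  regroup : ∀ j → suc (j ℕ.+ j) ℕ.+ suc (j ℕ.+ j) ℕ.* j ℕ.+ suc j ≡ suc (suc (j ℕ.+ j)) ℕ.* suc j
  regroup = ℕSolver.solve-∀

-1^-even : ∀ j → -1ℤ ℤ.^ (j ℕ.+ j) ≡ 1ℤ
-1^-even zero    = refl
-1^-even (suc j) = trans (cong (λ k → -1ℤ ℤ.^ suc k) (ℕP.+-suc j j)) (trans (double-negation (-1ℤ ℤ.^ (j ℕ.+ j))) (-1^-even j))
  where double-negation : ∀ x → -1ℤ * (-1ℤ * x) ≡ x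
        double-negation = solve-∀

-1^-odd : ∀ j → -1ℤ ℤ.^ suc (j ℕ.+ j) ≡ -1ℤ
-1^-odd j = cong (-1ℤ *_) (-1^-even j)

multiset : (ℕ → ℕ) → ℕ → List ℤ
multiset V zero    = []
multiset V (suc r) = replicate (V r) (+ r) ++ multiset V r

multiset-cong : ∀ {V W} r → (∀ z → z ℕ.< r → V z ≡ W z) → multiset V r ≡ multiset W r
multiset-cong zero    V≡W = refl
multiset-cong (suc r) V≡W = cong₂ (λ k → replicate k (+ r) ++_) (V≡W r ℕP.≤-refl) (multiset-cong r (λ z z<r → V≡W z (ℕP.m<n⇒m<1+n z<r)))

multiset-zero : ∀ r → multiset (λ _ → 0) r ≡ []
multiset-zero zero    = refl
multiset-zero (suc r) = multiset-zero r

replicate-+ : ∀ {A : Set} k l (a : A) → replicate (k ℕ.+ l) a ≡ replicate k a ++ replicate l a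
replicate-+ zero    l a = refl
replicate-+ (suc k) l a = cong (a ∷_) (replicate-+ k l a)

length-multiset-+ : ∀ V W r → length (multiset (λ z → V z ℕ.+ W z) r) ≡ length (multiset V r) ℕ.+ length (multiset W r)
length-multiset-+ V W zero    = refl
length-multiset-+ V W (suc r) = begin
  length (replicate (V r ℕ.+ W r) (+ r) ++ multiset (λ z → V z ℕ.+ W z) r)
    ≡⟨ ListP.length-++ (replicate (V r ℕ.+ W r) (+ r)) ⟩
  length (replicate (V r ℕ.+ W r) (+ r)) ℕ.+ length (multiset (λ z → V z ℕ.+ W z) r)
    ≡⟨ cong₂ ℕ._+_ (ListP.length-replicate (V r ℕ.+ W r)) (length-multiset-+ V W r) ⟩
  (V r ℕ.+ W r) ℕ.+ (length (multiset V r) ℕ.+ length (multiset W r))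
    ≡⟨ interchange (V r) (W r) _ _ ⟩
  (V r ℕ.+ length (multiset V r)) ℕ.+ (W r ℕ.+ length (multiset W r))
    ≡⟨ cong₂ ℕ._+_ (length-replicate-++ V) (length-replicate-++ W) ⟨
  length (replicate (V r) (+ r) ++ multiset V r) ℕ.+ length (replicate (W r) (+ r) ++ multiset W r) ∎
  where
  open ≡-Reasoning
  interchange : ∀ a b c d → (a ℕ.+ b) ℕ.+ (c ℕ.+ d) ≡ (a ℕ.+ c) ℕ.+ (b ℕ.+ d)
  interchange = ℕSolver.solve-∀
  length-replicate-++ : ∀ U → length (replicate (U r) (+ r) ++ multiset U r) ≡ U r ℕ.+ length (multiset U r)
  length-replicate-++ U = trans (ListP.length-++ (replicate (U r) (+ r))) (cong (ℕ._+ length (multiset U r)) (ListP.length-replicate (U r)))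

length-multiset-const : ∀ m r → length (multiset (λ _ → m) r) ≡ r ℕ.* m
length-multiset-const m zero    = refl
length-multiset-const m (suc r) =
  trans (ListP.length-++ (replicate m (+ r))) (cong₂ ℕ._+_ (ListP.length-replicate m) (length-multiset-const m r))

-- Polynomials in Y over the group ring ℤ[ℤ/N] = ℤ[u]: mono c e g stands for c·u^g·Y^e, and coeff p e x is the
-- coefficient of u^x·Y^e in p; u-exponents only matter modulo N.
module GroupRingPolynomials (N : ℕ) where

  record Monomial : Set where
    constructor mono
    field
      coef : ℤ
      deg  : ℕ
      uexp : ℤ
  open Monomial public

  Poly : Set
  Poly = List Monomial

  χ : ℤ → ℤ
  χ z with + N ∣? z
  ... | yes _ = 1ℤ
  ... | no  _ = 0ℤ

  coeffₘ : Monomial → ℕ → ℤ → ℤ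
  coeffₘ t e x with deg t ℕ.≟ e
  ... | yes _ = coef t * χ (uexp t - x)
  ... | no  _ = 0ℤ

  coeff : Poly → ℕ → ℤ → ℤ
  coeff p e x = ∑ (λ t → coeffₘ t e x) p

  χ-cong : ∀ {z z′} → + N ∣ z - z′ → χ z ≡ χ z′
  χ-cong {z} {z′} N∣z-z′ with + N ∣? z | + N ∣? z′
  ... | yes _    | yes _     = refl
  ... | no  _    | no  _     = refl
  ... | yes N∣z  | no  N∤z′  = ⊥-elim (N∤z′ (subst (+ N ∣_) (z-[z-z′] z z′) (∣m∣n⇒∣m-n N∣z N∣z-z′)))
    where z-[z-z′] : ∀ z z′ → z - (z - z′) ≡ z′
          z-[z-z′] = solve-∀
  ... | no  N∤z  | yes N∣z′  = ⊥-elim (N∤z (subst (+ N ∣_) (z′+[z-z′] z z′) (∣m∣n⇒∣m+n N∣z′ N∣z-z′)))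
    where z′+[z-z′] : ∀ z z′ → z′ + (z - z′) ≡ z
          z′+[z-z′] = solve-∀

  coeffₘ-deg≡ : ∀ t {e} x → deg t ≡ e → coeffₘ t e x ≡ coef t * χ (uexp t - x)
  coeffₘ-deg≡ t {e} x eq with deg t ℕ.≟ e
  ... | yes _  = refl
  ... | no  ne = ⊥-elim (ne eq)

  coeffₘ-deg≢ : ∀ t {e} x → deg t ≢ e → coeffₘ t e x ≡ 0ℤ
  coeffₘ-deg≢ t {e} x ne with deg t ℕ.≟ e
  ... | yes eq = ⊥-elim (ne eq)
  ... | no  _  = refl

  coeff-++ : ∀ p q e x → coeff (p ++ q) e x ≡ coeff p e x + coeff q e x
  coeff-++ p q e x = ∑-++ (λ t → coeffₘ t e x) p q

  infix 4 _≈ₚ_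
  record _≈ₚ_ (p q : Poly) : Set where
    constructor mk≈ₚ
    field coeff-≡ : ∀ e x → coeff p e x ≡ coeff q e x
  open _≈ₚ_ public

  ≈ₚ-setoid : Setoid _ _
  ≈ₚ-setoid = record
    { Carrier       = Poly
    ; _≈_           = _≈ₚ_
    ; isEquivalence = record
      { refl  = mk≈ₚ λ _ _ → refl
      ; sym   = λ p≈q → mk≈ₚ λ e x → sym (coeff-≡ p≈q e x)
      ; trans = λ p≈q q≈r → mk≈ₚ λ e x → trans (coeff-≡ p≈q e x) (coeff-≡ q≈r e x)
      }
    }

  open Setoid ≈ₚ-setoid public using () renaming (refl to ≈ₚ-refl; sym to ≈ₚ-sym; trans to ≈ₚ-trans; reflexive to ≈ₚ-reflexive)

  infixl 7 _·ₘ_ _*ₚ_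
  _·ₘ_ : Monomial → Monomial → Monomial
  mono c e g ·ₘ mono c′ e′ g′ = mono (c * c′) (e ℕ.+ e′) (g + g′)

  _*ₚ_ : Poly → Poly → Poly
  []      *ₚ q = []
  (t ∷ p) *ₚ q = map (t ·ₘ_) q ++ p *ₚ q

  1ₚ : Poly
  1ₚ = mono 1ℤ 0 0ℤ ∷ []

  ·ₘ-comm : ∀ t t′ → t ·ₘ t′ ≡ t′ ·ₘ t
  ·ₘ-comm (mono c e g) (mono c′ e′ g′) rewrite ℤP.*-comm c c′ | ℕP.+-comm e e′ | ℤP.+-comm g g′ = refl

  ·ₘ-assoc : ∀ t t′ t″ → (t ·ₘ t′) ·ₘ t″ ≡ t ·ₘ (t′ ·ₘ t″)
  ·ₘ-assoc (mono c e g) (mono c′ e′ g′) (mono c″ e″ g″)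
    rewrite ℤP.*-assoc c c′ c″ | ℕP.+-assoc e e′ e″ | ℤP.+-assoc g g′ g″ = refl

  ·ₘ-identityˡ : ∀ t → mono 1ℤ 0 0ℤ ·ₘ t ≡ t
  ·ₘ-identityˡ (mono c e g) rewrite ℤP.*-identityˡ c | ℤP.+-identityˡ g = refl

  mulCoeff : Monomial → (ℕ → ℤ → ℤ) → ℕ → ℤ → ℤ
  mulCoeff t f e x with deg t ℕ.≤? e
  ... | yes _ = coef t * f (e ℕ.∸ deg t) (x - uexp t)
  ... | no  _ = 0ℤ

  mulCoeff-cong : ∀ t {f g : ℕ → ℤ → ℤ} → (∀ e x → f e x ≡ g e x) → ∀ e x → mulCoeff t f e x ≡ mulCoeff t g e x
  mulCoeff-cong t f≡g e x with deg t ℕ.≤? e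
  ... | yes _ = cong (coef t *_) (f≡g _ _)
  ... | no  _ = refl

  coeffₘ-·ₘ : ∀ t t′ e x → coeffₘ (t ·ₘ t′) e x ≡ mulCoeff t (coeffₘ t′) e x
  coeffₘ-·ₘ t@(mono c e₁ g) t′@(mono c′ e₂ g′) e x with e₁ ℕ.≤? e
  ... | no e₁≰e = coeffₘ-deg≢ (t ·ₘ t′) x (λ eq → e₁≰e (subst (e₁ ℕ.≤_) eq (ℕP.m≤m+n e₁ e₂)))
  ... | yes e₁≤e with e₁ ℕ.+ e₂ ℕ.≟ e | e₂ ℕ.≟ e ℕ.∸ e₁
  ...   | yes _  | yes _  = regroup c c′ g g′ x
    where regroup : ∀ c c′ g g′ x → c * c′ * χ ((g + g′) - x) ≡ c * (c′ * χ (g′ - (x - g)))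
          regroup c c′ g g′ x = trans (ℤP.*-assoc c c′ _) (cong (λ z → c * (c′ * χ z)) (shuffle g g′ x))
            where shuffle : ∀ g g′ x → (g + g′) - x ≡ g′ - (x - g)
                  shuffle = solve-∀
  ...   | yes eq | no ne  = ⊥-elim (ne (trans (sym (ℕP.m+n∸m≡n e₁ e₂)) (cong (ℕ._∸ e₁) eq)))
  ...   | no ne  | yes eq = ⊥-elim (ne (trans (cong (e₁ ℕ.+_) eq) (ℕP.m+[n∸m]≡n e₁≤e)))
  ...   | no _   | no _   = sym (ℤP.*-zeroʳ c)

  mulCoeff-∑ : ∀ t q e x → ∑ (λ t′ → mulCoeff t (coeffₘ t′) e x) q ≡ mulCoeff t (coeff q) e x
  mulCoeff-∑ t q e x with deg t ℕ.≤? e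
  ... | yes _ = ∑-*ˡ (coef t) (λ t′ → coeffₘ t′ _ _) q
  ... | no  _ = ∑-zero (λ _ → refl) q

  coeff-map-·ₘ : ∀ t q e x → coeff (map (t ·ₘ_) q) e x ≡ mulCoeff t (coeff q) e x
  coeff-map-·ₘ t q e x = begin
    coeff (map (t ·ₘ_) q) e x                   ≡⟨ ∑-map (λ t′ → coeffₘ t′ e x) (t ·ₘ_) q ⟩
    ∑ (λ t′ → coeffₘ (t ·ₘ t′) e x) q            ≡⟨ ∑-cong (λ t′ → coeffₘ-·ₘ t t′ e x) q ⟩
    ∑ (λ t′ → mulCoeff t (coeffₘ t′) e x) q      ≡⟨ mulCoeff-∑ t q e x ⟩
    mulCoeff t (coeff q) e x                    ∎
    where open ≡-Reasoning

  coeff-*ₚ : ∀ p q e x → coeff (p *ₚ q) e x ≡ ∑ (λ t → mulCoeff t (coeff q) e x) p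
  coeff-*ₚ []      q e x = refl
  coeff-*ₚ (t ∷ p) q e x =
    trans (coeff-++ (map (t ·ₘ_) q) (p *ₚ q) e x) (cong₂ _+_ (coeff-map-·ₘ t q e x) (coeff-*ₚ p q e x))

  coeff-*ₚ-double : ∀ p q e x → coeff (p *ₚ q) e x ≡ ∑ (λ t → ∑ (λ t′ → coeffₘ (t ·ₘ t′) e x) q) p
  coeff-*ₚ-double []      q e x = refl
  coeff-*ₚ-double (t ∷ p) q e x =
    trans (coeff-++ (map (t ·ₘ_) q) (p *ₚ q) e x)
          (cong₂ _+_ (∑-map (λ t′ → coeffₘ t′ e x) (t ·ₘ_) q) (coeff-*ₚ-double p q e x))

  *ₚ-comm : ∀ p q → p *ₚ q ≈ₚ q *ₚ p
  *ₚ-comm p q = mk≈ₚ λ e x → begin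
    coeff (p *ₚ q) e x                                ≡⟨ coeff-*ₚ-double p q e x ⟩
    ∑ (λ t → ∑ (λ t′ → coeffₘ (t ·ₘ t′) e x) q) p     ≡⟨ ∑-swap (λ t t′ → coeffₘ (t ·ₘ t′) e x) p q ⟩
    ∑ (λ t′ → ∑ (λ t → coeffₘ (t ·ₘ t′) e x) p) q
      ≡⟨ ∑-cong (λ t′ → ∑-cong (λ t → cong (λ s → coeffₘ s e x) (·ₘ-comm t t′)) p) q ⟩
    ∑ (λ t′ → ∑ (λ t → coeffₘ (t′ ·ₘ t) e x) p) q     ≡⟨ coeff-*ₚ-double q p e x ⟨
    coeff (q *ₚ p) e x                                ∎
    where open ≡-Reasoning

  *ₚ-congʳ : ∀ p {q q′} → q ≈ₚ q′ → p *ₚ q ≈ₚ p *ₚ q′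
  *ₚ-congʳ p {q} {q′} q≈q′ = mk≈ₚ λ e x →
    trans (coeff-*ₚ p q e x)
          (trans (∑-cong (λ t → mulCoeff-cong t (coeff-≡ q≈q′) e x) p) (sym (coeff-*ₚ p q′ e x)))

  *ₚ-cong : ∀ {p p′ q q′} → p ≈ₚ p′ → q ≈ₚ q′ → p *ₚ q ≈ₚ p′ *ₚ q′
  *ₚ-cong {p} {p′} {q} {q′} p≈p′ q≈q′ =
    ≈ₚ-trans (*ₚ-comm p q) (≈ₚ-trans (*ₚ-congʳ q p≈p′) (≈ₚ-trans (*ₚ-comm q p′) (*ₚ-congʳ p′ q≈q′)))

  *ₚ-distribʳ-++ : ∀ p p′ q → (p ++ p′) *ₚ q ≡ p *ₚ q ++ p′ *ₚ q
  *ₚ-distribʳ-++ []      p′ q = refl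
  *ₚ-distribʳ-++ (t ∷ p) p′ q =
    trans (cong (map (t ·ₘ_) q ++_) (*ₚ-distribʳ-++ p p′ q)) (sym (ListP.++-assoc (map (t ·ₘ_) q) (p *ₚ q) (p′ *ₚ q)))

  map-·ₘ-*ₚ : ∀ t q r → map (t ·ₘ_) q *ₚ r ≡ map (t ·ₘ_) (q *ₚ r)
  map-·ₘ-*ₚ t []       r = refl
  map-·ₘ-*ₚ t (t′ ∷ q) r = begin
    map ((t ·ₘ t′) ·ₘ_) r ++ map (t ·ₘ_) q *ₚ r          ≡⟨ cong₂ _++_ (ListP.map-cong (·ₘ-assoc t t′) r) (map-·ₘ-*ₚ t q r) ⟩
    map (λ t″ → t ·ₘ (t′ ·ₘ t″)) r ++ map (t ·ₘ_) (q *ₚ r) ≡⟨ cong (_++ _) (ListP.map-∘ r) ⟩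
    map (t ·ₘ_) (map (t′ ·ₘ_) r) ++ map (t ·ₘ_) (q *ₚ r)   ≡⟨ ListP.map-++ (t ·ₘ_) (map (t′ ·ₘ_) r) (q *ₚ r) ⟨
    map (t ·ₘ_) (map (t′ ·ₘ_) r ++ q *ₚ r)                ∎
    where open ≡-Reasoning

  *ₚ-assoc : ∀ p q r → (p *ₚ q) *ₚ r ≡ p *ₚ (q *ₚ r)
  *ₚ-assoc []      q r = refl
  *ₚ-assoc (t ∷ p) q r =
    trans (*ₚ-distribʳ-++ (map (t ·ₘ_) q) (p *ₚ q) r) (cong₂ _++_ (map-·ₘ-*ₚ t q r) (*ₚ-assoc p q r))

  *ₚ-identityˡ : ∀ p → 1ₚ *ₚ p ≡ p
  *ₚ-identityˡ p = trans (ListP.++-identityʳ _) (trans (ListP.map-cong ·ₘ-identityˡ p) (ListP.map-id p))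

  *ₚ-isCommutativeMonoid : IsCommutativeMonoid _≈ₚ_ _*ₚ_ 1ₚ
  *ₚ-isCommutativeMonoid = record
    { isMonoid = record
      { isSemigroup = record
        { isMagma = record { isEquivalence = Setoid.isEquivalence ≈ₚ-setoid ; ∙-cong = *ₚ-cong }
        ; assoc   = λ p q r → ≈ₚ-reflexive (*ₚ-assoc p q r)
        }
      ; identity = (λ p → ≈ₚ-reflexive (*ₚ-identityˡ p))
                 , (λ p → ≈ₚ-trans (*ₚ-comm p 1ₚ) (≈ₚ-reflexive (*ₚ-identityˡ p)))
      }
    ; comm = *ₚ-comm
    }

  open IsCommutativeMonoid *ₚ-isCommutativeMonoid public using () renaming (identityʳ to *ₚ-identityʳ)

  *ₚ-commutativeSemigroup : CommutativeSemigroup _ _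
  *ₚ-commutativeSemigroup = record { isCommutativeSemigroup = IsCommutativeMonoid.isCommutativeSemigroup *ₚ-isCommutativeMonoid }

  open Algebra.Properties.CommutativeSemigroup *ₚ-commutativeSemigroup public
    using (x∙yz≈y∙xz) renaming (interchange to *ₚ-interchange)

  infixr 8 _^ₚ_
  _^ₚ_ : Poly → ℕ → Poly
  p ^ₚ zero  = 1ₚ
  p ^ₚ suc m = p *ₚ p ^ₚ m

  Deg≤ : ℕ → Poly → Set
  Deg≤ D = All (λ t → deg t ℕ.≤ D)

  coeff-deg> : ∀ {D p} → Deg≤ D p → ∀ {e} x → D ℕ.< e → coeff p e x ≡ 0ℤ
  coeff-deg> []                 x D<e = refl
  coeff-deg> {p = t ∷ _} (t≤D ∷ p≤D) x D<e =
    cong₂ _+_ (coeffₘ-deg≢ t x (λ eq → ℕP.<-irrefl eq (ℕP.≤-<-trans t≤D D<e))) (coeff-deg> p≤D x D<e)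

  Deg≤-++ : ∀ {D p q} → Deg≤ D p → Deg≤ D q → Deg≤ D (p ++ q)
  Deg≤-++ []          q≤D = q≤D
  Deg≤-++ (t≤D ∷ p≤D) q≤D = t≤D ∷ Deg≤-++ p≤D q≤D

  Deg≤-*ₚ : ∀ {D D′ p q} → Deg≤ D p → Deg≤ D′ q → Deg≤ (D ℕ.+ D′) (p *ₚ q)
  Deg≤-*ₚ {p = []}    []          q≤D′ = []
  Deg≤-*ₚ {p = t ∷ p} (t≤D ∷ p≤D) q≤D′ = Deg≤-++ (map-≤ q≤D′) (Deg≤-*ₚ p≤D q≤D′)
    where
    map-≤ : ∀ {q} → Deg≤ _ q → Deg≤ _ (map (t ·ₘ_) q)
    map-≤ []            = []
    map-≤ (t′≤D′ ∷ q≤D′) = ℕP.+-mono-≤ t≤D t′≤D′ ∷ map-≤ q≤D′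

  countDeg : ℕ → Poly → ℕ
  countDeg k []      = 0
  countDeg k (t ∷ T) with deg t ℕ.≟ k
  ... | yes _ = suc (countDeg k T)
  ... | no  _ = countDeg k T

  -- A polynomial of degree 0 is an element of ℤ[ℤ/N]; it acts on functions ℤ → ℤ by convolution.
  act : Poly → (ℤ → ℤ) → ℤ → ℤ
  act P f x = ∑ (λ t → coef t * f (x - uexp t)) P

  act-cong : ∀ P {f g} → (∀ y → f y ≡ g y) → ∀ x → act P f x ≡ act P g x
  act-cong P f≡g x = ∑-cong (λ t → cong (coef t *_) (f≡g _)) P

  act-zero : ∀ P {f} → (∀ y → f y ≡ 0ℤ) → ∀ x → act P f x ≡ 0ℤ
  act-zero P f≡0 x = ∑-zero (λ t → trans (cong (coef t *_) (f≡0 _)) (ℤP.*-zeroʳ (coef t))) P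

  act-+ : ∀ P f g x → act P (λ y → f y + g y) x ≡ act P f x + act P g x
  act-+ P f g x = trans (∑-cong (λ t → ℤP.*-distribˡ-+ (coef t) _ _) P) (∑-+ _ _ P)

  act-neg : ∀ P f x → act P (λ y → - f y) x ≡ - act P f x
  act-neg P f x = begin
    act P (λ y → - f y) x                   ≡⟨ ∑-cong (λ t → trans (sym (ℤP.neg-distribʳ-* (coef t) _)) (sym (ℤP.-1*i≡-i _))) P ⟩
    ∑ (λ t → -1ℤ * (coef t * f (x - uexp t))) P ≡⟨ ∑-*ˡ -1ℤ _ P ⟩
    -1ℤ * act P f x                         ≡⟨ ℤP.-1*i≡-i _ ⟩
    - act P f x                             ∎
    where open ≡-Reasoning

  act-shift : ∀ P f s x → act P (λ y → f (y - s)) x ≡ act P f (x - s)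
  act-shift P f s x = ∑-cong (λ t → cong (λ z → coef t * f z) (swap-shifts x (uexp t) s)) P
    where swap-shifts : ∀ x g s → (x - g) - s ≡ (x - s) - g
          swap-shifts = solve-∀

  ·ₘ-convolution : ∀ t t′ (f : ℤ → ℤ) x →
                   coef (t ·ₘ t′) * f (x - uexp (t ·ₘ t′)) ≡ coef t * (coef t′ * f ((x - uexp t) - uexp t′))
  ·ₘ-convolution (mono c _ g) (mono c′ _ g′) f x =
    trans (ℤP.*-assoc c c′ _) (cong (λ z → c * (c′ * f z)) (split x g g′))
    where split : ∀ x g g′ → x - (g + g′) ≡ (x - g) - g′
          split = solve-∀

  act-*ₚ : ∀ P Q f x → act (P *ₚ Q) f x ≡ act P (act Q f) x
  act-*ₚ []      Q f x = refl
  act-*ₚ (t ∷ P) Q f x = begin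
    act (map (t ·ₘ_) Q ++ P *ₚ Q) f x          ≡⟨ ∑-++ _ (map (t ·ₘ_) Q) (P *ₚ Q) ⟩
    act (map (t ·ₘ_) Q) f x + act (P *ₚ Q) f x ≡⟨ cong₂ _+_ act-map-·ₘ (act-*ₚ P Q f x) ⟩
    coef t * act Q f (x - uexp t) + act P (act Q f) x ∎
    where
    open ≡-Reasoning
    act-map-·ₘ : act (map (t ·ₘ_) Q) f x ≡ coef t * act Q f (x - uexp t)
    act-map-·ₘ = trans (∑-map _ (t ·ₘ_) Q) (trans (∑-cong (λ t′ → ·ₘ-convolution t t′ f x) Q) (∑-*ˡ (coef t) _ Q))

  mulCoeff-deg0 : ∀ t f e x → deg t ≡ 0 → mulCoeff t f e x ≡ coef t * f e (x - uexp t)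
  mulCoeff-deg0 t f e x deg≡0 with deg t ℕ.≤? e
  ... | yes _   = cong (λ d → coef t * f (e ℕ.∸ d) (x - uexp t)) deg≡0
  ... | no  d≰e = ⊥-elim (d≰e (subst (ℕ._≤ e) (sym deg≡0) z≤n))

  coeff-*ₚ-deg0 : ∀ {P} → Deg≤ 0 P → ∀ Q e x → coeff (P *ₚ Q) e x ≡ act P (coeff Q e) x
  coeff-*ₚ-deg0 {P} P≤0 Q e x = trans (coeff-*ₚ P Q e x) (go P≤0)
    where
    go : ∀ {P} → Deg≤ 0 P → ∑ (λ t → mulCoeff t (coeff Q) e x) P ≡ act P (coeff Q e) x
    go []                   = refl
    go {t ∷ _} (t≤0 ∷ P≤0) = cong₂ _+_ (mulCoeff-deg0 t (coeff Q) e x (ℕP.n≤0⇒n≡0 t≤0)) (go P≤0)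

  1-u^_Y^_ : ℤ → ℕ → Poly
  1-u^ g Y^ d = mono 1ℤ 0 0ℤ ∷ mono -1ℤ d g ∷ []

  mulCoeff-≥ : ∀ t f {e} x → deg t ℕ.≤ e → mulCoeff t f e x ≡ coef t * f (e ℕ.∸ deg t) (x - uexp t)
  mulCoeff-≥ t f {e} x d≤e with deg t ℕ.≤? e
  ... | yes _   = refl
  ... | no  d≰e = ⊥-elim (d≰e d≤e)

  mulCoeff-< : ∀ t f {e} x → e ℕ.< deg t → mulCoeff t f e x ≡ 0ℤ
  mulCoeff-< t f {e} x e<d with deg t ℕ.≤? e
  ... | yes d≤e = ⊥-elim (ℕP.<-irrefl refl (ℕP.<-≤-trans e<d d≤e))
  ... | no  _   = refl

  mulCoeff-1ₚ : ∀ f e x → mulCoeff (mono 1ℤ 0 0ℤ) f e x ≡ f e x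
  mulCoeff-1ₚ f e x = trans (mulCoeff-deg0 (mono 1ℤ 0 0ℤ) f e x refl) (trans (ℤP.*-identityˡ _) (cong (f e) (ℤP.+-identityʳ x)))

  coeff-1-u^Y^*-< : ∀ g d X {e} x → e ℕ.< d → coeff (1-u^ g Y^ d *ₚ X) e x ≡ coeff X e x
  coeff-1-u^Y^*-< g d X {e} x e<d = begin
    coeff (1-u^ g Y^ d *ₚ X) e x                                               ≡⟨ coeff-*ₚ (1-u^ g Y^ d) X e x ⟩
    mulCoeff (mono 1ℤ 0 0ℤ) (coeff X) e x + (mulCoeff (mono -1ℤ d g) (coeff X) e x + 0ℤ)
      ≡⟨ cong₂ _+_ (mulCoeff-1ₚ (coeff X) e x) (cong (_+ 0ℤ) (mulCoeff-< (mono -1ℤ d g) (coeff X) x e<d)) ⟩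
    coeff X e x + 0ℤ                                                           ≡⟨ ℤP.+-identityʳ _ ⟩
    coeff X e x                                                                ∎
    where open ≡-Reasoning

  coeff-1-u^Y^*-≥ : ∀ g d X {e} x → d ℕ.≤ e → coeff (1-u^ g Y^ d *ₚ X) e x ≡ coeff X e x - coeff X (e ℕ.∸ d) (x - g)
  coeff-1-u^Y^*-≥ g d X {e} x d≤e = begin
    coeff (1-u^ g Y^ d *ₚ X) e x                                               ≡⟨ coeff-*ₚ (1-u^ g Y^ d) X e x ⟩
    mulCoeff (mono 1ℤ 0 0ℤ) (coeff X) e x + (mulCoeff (mono -1ℤ d g) (coeff X) e x + 0ℤ)
      ≡⟨ cong₂ _+_ (mulCoeff-1ₚ (coeff X) e x) (ℤP.+-identityʳ _) ⟩
    coeff X e x + mulCoeff (mono -1ℤ d g) (coeff X) e x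
      ≡⟨ cong (_+_ (coeff X e x)) (trans (mulCoeff-≥ (mono -1ℤ d g) (coeff X) x d≤e) (ℤP.-1*i≡-i _)) ⟩
    coeff X e x - coeff X (e ℕ.∸ d) (x - g)                                    ∎
    where open ≡-Reasoning

  coeffₘ-uexp-cong : ∀ c d {g g′} → + N ∣ g - g′ → ∀ e x → coeffₘ (mono c d g) e x ≡ coeffₘ (mono c d g′) e x
  coeffₘ-uexp-cong c d {g} {g′} N∣g-g′ e x with d ℕ.≟ e
  ... | yes _ = cong (c *_) (χ-cong (subst (+ N ∣_) (cancel g g′ x) N∣g-g′))
    where cancel : ∀ g g′ x → g - g′ ≡ (g - x) - (g′ - x)
          cancel = solve-∀
  ... | no  _ = refl

  1-u^Y^-cong : ∀ {g g′} d → + N ∣ g - g′ → 1-u^ g Y^ d ≈ₚ 1-u^ g′ Y^ d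
  1-u^Y^-cong d N∣g-g′ = mk≈ₚ λ e x → cong (λ z → coeffₘ (mono 1ℤ 0 0ℤ) e x + (z + 0ℤ)) (coeffₘ-uexp-cong -1ℤ d N∣g-g′ e x)

  infix 9 ∏1-u^_Y
  ∏1-u^_Y : List ℤ → Poly
  ∏1-u^ []       Y = 1ₚ
  ∏1-u^ (y ∷ ys) Y = 1-u^ y Y^ 1 *ₚ ∏1-u^ ys Y

  ∏1-u^Y-++ : ∀ xs ys → ∏1-u^ (xs ++ ys) Y ≈ₚ ∏1-u^ xs Y *ₚ ∏1-u^ ys Y
  ∏1-u^Y-++ []       ys = ≈ₚ-reflexive (sym (*ₚ-identityˡ _))
  ∏1-u^Y-++ (x ∷ xs) ys =
    ≈ₚ-trans (*ₚ-congʳ (1-u^ x Y^ 1) (∏1-u^Y-++ xs ys)) (≈ₚ-reflexive (sym (*ₚ-assoc (1-u^ x Y^ 1) (∏1-u^ xs Y) _)))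

  Deg≤-∏1-u^Y : ∀ ys → Deg≤ (length ys) (∏1-u^ ys Y)
  Deg≤-∏1-u^Y []       = z≤n ∷ []
  Deg≤-∏1-u^Y (y ∷ ys) = Deg≤-*ₚ {p = 1-u^ y Y^ 1} (z≤n ∷ ℕP.≤-refl ∷ []) (Deg≤-∏1-u^Y ys)

  coeff-∏1-u^Y-0 : ∀ ys x → coeff (∏1-u^ ys Y) 0 x ≡ coeff 1ₚ 0 x
  coeff-∏1-u^Y-0 []       x = refl
  coeff-∏1-u^Y-0 (y ∷ ys) x = trans (coeff-1-u^Y^*-< y 1 (∏1-u^ ys Y) x (s≤s z≤n)) (coeff-∏1-u^Y-0 ys x)

  coeff-∏1-u^Y-top : ∀ ys x → coeff (∏1-u^ ys Y) (length ys) x ≡ -1ℤ ℤ.^ length ys * χ (∑ (λ y → y) ys - x)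
  coeff-∏1-u^Y-top []       x = ℤP.+-identityʳ _
  coeff-∏1-u^Y-top (y ∷ ys) x = begin
    coeff (1-u^ y Y^ 1 *ₚ ∏1-u^ ys Y) (suc ℓ) x                  ≡⟨ coeff-1-u^Y^*-≥ y 1 (∏1-u^ ys Y) x (s≤s z≤n) ⟩
    coeff (∏1-u^ ys Y) (suc ℓ) x - coeff (∏1-u^ ys Y) ℓ (x - y)
      ≡⟨ cong₂ _-_ (coeff-deg> (Deg≤-∏1-u^Y ys) x ℕP.≤-refl) (coeff-∏1-u^Y-top ys (x - y)) ⟩
    0ℤ - -1ℤ ℤ.^ ℓ * χ (∑ (λ y → y) ys - (x - y))                ≡⟨ cong (λ z → 0ℤ - -1ℤ ℤ.^ ℓ * χ z) (regroup (∑ (λ y → y) ys) x y) ⟩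
    0ℤ - -1ℤ ℤ.^ ℓ * χ ((y + ∑ (λ y → y) ys) - x)                ≡⟨ negate (-1ℤ ℤ.^ ℓ) _ ⟩
    -1ℤ ℤ.^ suc ℓ * χ ((y + ∑ (λ y → y) ys) - x)                 ∎
    where
    open ≡-Reasoning
    ℓ = length ys
    regroup : ∀ s x y → s - (x - y) ≡ (y + s) - x
    regroup = solve-∀
    negate : ∀ a c → 0ℤ - a * c ≡ -1ℤ * a * c
    negate = solve-∀

  -- The substitution Y ↦ u^s·Y.
  twist : ℤ → Monomial → Monomial
  twist s (mono c e g) = mono c e (g + s * + e)

  twist-·ₘ : ∀ s t t′ → twist s (t ·ₘ t′) ≡ twist s t ·ₘ twist s t′
  twist-·ₘ s (mono c e g) (mono c′ e′ g′) =
    cong (mono (c * c′) (e ℕ.+ e′)) (trans (cong (λ z → (g + g′) + s * z) (ℤP.pos-+ e e′)) (distribute g g′ s (+ e) (+ e′)))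
    where distribute : ∀ g g′ s a b → (g + g′) + s * (a + b) ≡ (g + s * a) + (g′ + s * b)
          distribute = solve-∀

  twist-*ₚ : ∀ s p q → map (twist s) (p *ₚ q) ≡ map (twist s) p *ₚ map (twist s) q
  twist-*ₚ s []      q = refl
  twist-*ₚ s (t ∷ p) q = begin
    map (twist s) (map (t ·ₘ_) q ++ p *ₚ q)                  ≡⟨ ListP.map-++ (twist s) (map (t ·ₘ_) q) (p *ₚ q) ⟩
    map (twist s) (map (t ·ₘ_) q) ++ map (twist s) (p *ₚ q)  ≡⟨ cong₂ _++_ twist-map (twist-*ₚ s p q) ⟩
    map (twist s t ·ₘ_) (map (twist s) q) ++ map (twist s) p *ₚ map (twist s) q ∎
    where
    open ≡-Reasoning
    twist-map : map (twist s) (map (t ·ₘ_) q) ≡ map (twist s t ·ₘ_) (map (twist s) q)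
    twist-map = trans (sym (ListP.map-∘ q)) (trans (ListP.map-cong (twist-·ₘ s t) q) (ListP.map-∘ q))

  coeffₘ-twist : ∀ s t e x → coeffₘ (twist s t) e x ≡ coeffₘ t e (x - s * + e)
  coeffₘ-twist s (mono c d g) e x with d ℕ.≟ e
  ... | yes refl = cong (λ z → c * χ z) (regroup g s (+ d) x)
    where regroup : ∀ g s d x → (g + s * d) - x ≡ g - (x - s * d)
          regroup = solve-∀
  ... | no  _    = refl

  coeff-twist : ∀ s p e x → coeff (map (twist s) p) e x ≡ coeff p e (x - s * + e)
  coeff-twist s p e x = trans (∑-map (λ t → coeffₘ t e x) (twist s) p) (∑-cong (λ t → coeffₘ-twist s t e x) p)

  twist-∏1-u^Y : ∀ s ys → map (twist s) (∏1-u^ ys Y) ≡ ∏1-u^ (map (_+ s) ys) Y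
  twist-∏1-u^Y s []       = twist-1ₚ
    where twist-1ₚ : map (twist s) 1ₚ ≡ 1ₚ
          twist-1ₚ = cong (λ g → mono 1ℤ 0 g ∷ []) (trans (cong (_+_ (0ℤ)) (ℤP.*-zeroʳ s)) (ℤP.+-identityˡ 0ℤ))
  twist-∏1-u^Y s (y ∷ ys) = begin
    map (twist s) (1-u^ y Y^ 1 *ₚ ∏1-u^ ys Y)                    ≡⟨ twist-*ₚ s (1-u^ y Y^ 1) (∏1-u^ ys Y) ⟩
    map (twist s) (1-u^ y Y^ 1) *ₚ map (twist s) (∏1-u^ ys Y)    ≡⟨ cong₂ _*ₚ_ twist-factor (twist-∏1-u^Y s ys) ⟩
    1-u^ (y + s) Y^ 1 *ₚ ∏1-u^ (map (_+ s) ys) Y                 ∎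
    where
    open ≡-Reasoning
    twist-factor : map (twist s) (1-u^ y Y^ 1) ≡ 1-u^ (y + s) Y^ 1
    twist-factor = cong₂ (λ g g′ → mono 1ℤ 0 g ∷ mono -1ℤ 1 g′ ∷ [])
                         (trans (cong (_+_ (0ℤ)) (ℤP.*-zeroʳ s)) (ℤP.+-identityˡ 0ℤ)) (cong (_+_ (y)) (ℤP.*-identityʳ s))

  progression-wraps-around : ∀ b n d → n ℕ.* suc d ≡ N → + N ∣ ((b + + n) + + (n ℕ.* d)) - b
  progression-wraps-around b n d nd = divides 1ℤ (begin
    ((b + + n) + + (n ℕ.* d)) - b ≡⟨ cong (_- b) (trans (progression-step b n d) (cong (λ k → b + + k) nd)) ⟩
    (b + + N) - b                 ≡⟨ cancel b (+ N) ⟩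
    1ℤ * + N                      ∎)
    where
    open ≡-Reasoning
    cancel : ∀ b N → (b + N) - b ≡ 1ℤ * N
    cancel = solve-∀

  -- With n·d = N the progression is a full coset of the subgroup generated by n, so Y ↦ u^n·Y permutes the factors.
  ∏1-u^Y-progression-rotation : ∀ b n d → n ℕ.* d ≡ N →
    map (twist (+ n)) (∏1-u^ progression b n d Y) ≈ₚ ∏1-u^ progression b n d Y
  ∏1-u^Y-progression-rotation b n zero    nd = ≈ₚ-reflexive (twist-∏1-u^Y (+ n) [])
  ∏1-u^Y-progression-rotation b n (suc d) nd = begin
    map (twist (+ n)) (∏1-u^ progression b n (suc d) Y)       ≡⟨ twist-∏1-u^Y (+ n) (progression b n (suc d)) ⟩
    ∏1-u^ map (_+ + n) (progression b n (suc d)) Y            ≡⟨ cong ∏1-u^_Y (progression-+ b n (suc d)) ⟩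
    ∏1-u^ progression (b + + n) n (suc d) Y                   ≡⟨ cong ∏1-u^_Y (progression-last (b + + n) n d) ⟩
    ∏1-u^ (progression (b + + n) n d ++ (b′ ∷ [])) Y          ≈⟨ ∏1-u^Y-++ (progression (b + + n) n d) (b′ ∷ []) ⟩
    P *ₚ ∏1-u^ (b′ ∷ []) Y                                   ≈⟨ *ₚ-congʳ P (*ₚ-identityʳ (1-u^ b′ Y^ 1)) ⟩
    P *ₚ 1-u^ b′ Y^ 1                                        ≈⟨ *ₚ-congʳ P (1-u^Y^-cong 1 (progression-wraps-around b n d nd)) ⟩
    P *ₚ 1-u^ b Y^ 1                                         ≈⟨ *ₚ-comm P (1-u^ b Y^ 1) ⟩
    ∏1-u^ progression b n (suc d) Y                          ∎
    where
    open import Relation.Binary.Reasoning.Setoid ≈ₚ-setoid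
    P  = ∏1-u^ progression (b + + n) n d Y
    b′ = (b + + n) + + (n ℕ.* d)

  ∏1-u^Y-multiset-+ : ∀ V W r → ∏1-u^ multiset (λ z → V z ℕ.+ W z) r Y ≈ₚ ∏1-u^ multiset V r Y *ₚ ∏1-u^ multiset W r Y
  ∏1-u^Y-multiset-+ V W zero    = ≈ₚ-reflexive (sym (*ₚ-identityˡ 1ₚ))
  ∏1-u^Y-multiset-+ V W (suc r) = begin
    ∏1-u^ (replicate (V r ℕ.+ W r) (+ r) ++ multiset (λ z → V z ℕ.+ W z) r) Y
      ≈⟨ ∏1-u^Y-++ (replicate (V r ℕ.+ W r) (+ r)) _ ⟩
    ∏1-u^ replicate (V r ℕ.+ W r) (+ r) Y *ₚ ∏1-u^ multiset (λ z → V z ℕ.+ W z) r Y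
      ≈⟨ *ₚ-cong (≈ₚ-trans (≈ₚ-reflexive (cong ∏1-u^_Y (replicate-+ (V r) (W r) (+ r)))) (∏1-u^Y-++ (replicate (V r) (+ r)) _))
                 (∏1-u^Y-multiset-+ V W r) ⟩
    (∏1-u^ replicate (V r) (+ r) Y *ₚ ∏1-u^ replicate (W r) (+ r) Y) *ₚ (∏1-u^ multiset V r Y *ₚ ∏1-u^ multiset W r Y)
      ≈⟨ *ₚ-interchange (∏1-u^ replicate (V r) (+ r) Y) (∏1-u^ replicate (W r) (+ r) Y) (∏1-u^ multiset V r Y) (∏1-u^ multiset W r Y) ⟩
    (∏1-u^ replicate (V r) (+ r) Y *ₚ ∏1-u^ multiset V r Y) *ₚ (∏1-u^ replicate (W r) (+ r) Y *ₚ ∏1-u^ multiset W r Y)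
      ≈⟨ *ₚ-cong (∏1-u^Y-++ (replicate (V r) (+ r)) _) (∏1-u^Y-++ (replicate (W r) (+ r)) _) ⟨
    ∏1-u^ multiset V (suc r) Y *ₚ ∏1-u^ multiset W (suc r) Y ∎
    where
    open import Relation.Binary.Reasoning.Setoid ≈ₚ-setoid

  ∏1-u^Y-multiset-const : ∀ m r → ∏1-u^ multiset (λ _ → m) r Y ≈ₚ (∏1-u^ multiset (λ _ → 1) r Y) ^ₚ m
  ∏1-u^Y-multiset-const zero    r = ≈ₚ-reflexive (cong ∏1-u^_Y (multiset-zero r))
  ∏1-u^Y-multiset-const (suc m) r =
    ≈ₚ-trans (∏1-u^Y-multiset-+ (λ _ → 1) (λ _ → m) r) (*ₚ-congʳ (∏1-u^ multiset (λ _ → 1) r Y) (∏1-u^Y-multiset-const m r))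

module SubsetExpansion (N : ℕ) where

  open GroupRingPolynomials N

  ∏1-u^Y^ : ∀ {r} → (Fin r → ℤ) → (Fin r → ℕ) → Poly
  ∏1-u^Y^ {zero}  g D = 1ₚ
  ∏1-u^Y^ {suc r} g D = 1-u^ g zero Y^ D zero *ₚ ∏1-u^Y^ (g ∘ suc) (D ∘ suc)

  subsetMonomial : ∀ {r} → (Fin r → ℤ) → (Fin r → ℕ) → Subset r → Monomial
  subsetMonomial {zero}  g D []            = mono 1ℤ 0 0ℤ
  subsetMonomial {suc r} g D (inside  ∷ I) = mono -1ℤ (D zero) (g zero) ·ₘ subsetMonomial (g ∘ suc) (D ∘ suc) I
  subsetMonomial {suc r} g D (outside ∷ I) = mono 1ℤ 0 0ℤ ·ₘ subsetMonomial (g ∘ suc) (D ∘ suc) I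

  ++-comm-≈ₚ : ∀ p q → p ++ q ≈ₚ q ++ p
  ++-comm-≈ₚ p q = mk≈ₚ λ e x → trans (coeff-++ p q e x) (trans (ℤP.+-comm (coeff p e x) (coeff q e x)) (sym (coeff-++ q p e x)))

  ∏1-u^Y^-expansion : ∀ {r} g D → ∏1-u^Y^ g D ≈ₚ map (subsetMonomial g D) (allSubsets r)
  ∏1-u^Y^-expansion {zero}  g D = ≈ₚ-refl
  ∏1-u^Y^-expansion {suc r} g D = begin
    1-u^ g zero Y^ D zero *ₚ ∏1-u^Y^ (g ∘ suc) (D ∘ suc)       ≈⟨ *ₚ-congʳ (1-u^ g zero Y^ D zero) (∏1-u^Y^-expansion (g ∘ suc) (D ∘ suc)) ⟩
    map (mono 1ℤ 0 0ℤ ·ₘ_) T ++ (map (t ·ₘ_) T ++ [])            ≡⟨ cong (map (mono 1ℤ 0 0ℤ ·ₘ_) T ++_) (ListP.++-identityʳ _) ⟩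
    map (mono 1ℤ 0 0ℤ ·ₘ_) T ++ map (t ·ₘ_) T                   ≈⟨ ++-comm-≈ₚ (map (mono 1ℤ 0 0ℤ ·ₘ_) T) (map (t ·ₘ_) T) ⟩
    map (t ·ₘ_) T ++ map (mono 1ℤ 0 0ℤ ·ₘ_) T
      ≡⟨ cong₂ _++_ (trans (sym (ListP.map-∘ S)) (ListP.map-∘ S)) (trans (sym (ListP.map-∘ S)) (ListP.map-∘ S)) ⟨
    map sm (map (inside ∷_) S) ++ map sm (map (outside ∷_) S)  ≡⟨ ListP.map-++ sm (map (inside ∷_) S) _ ⟨
    map sm (allSubsets (suc r))                                ∎
    where
    open import Relation.Binary.Reasoning.Setoid ≈ₚ-setoid
    S  = allSubsets r
    sm = subsetMonomial g D
    T  = map (subsetMonomial (g ∘ suc) (D ∘ suc)) S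
    t  = mono -1ℤ (D zero) (g zero)

  sum-filter-∈?-tabulate-suc : ∀ {r} b (I : Subset r) (D : Fin (suc r) → ℕ) →
    sum (map D (filter (_∈? (b ∷ I)) (tabulate suc))) ≡ sum (map (D ∘ suc) (filter (_∈? I) (allFin r)))
  sum-filter-∈?-tabulate-suc {r} b I D =
    trans (cong (sum ∘ map D) (trans (cong (filter (_∈? (b ∷ I))) (sym (ListP.map-tabulate (λ i → i) suc))) (filter-∈?-map-suc b I (allFin r))))
          (cong sum (sym (ListP.map-∘ (filter (_∈? I) (allFin r)))))

  deg-subsetMonomial : ∀ {r} g D (I : Subset r) → deg (subsetMonomial g D I) ≡ sum (map D (filter (_∈? I) (allFin r)))
  deg-subsetMonomial {zero}  g D []            = refl
  deg-subsetMonomial {suc r} g D (inside  ∷ I) =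
    cong (D zero ℕ.+_) (trans (deg-subsetMonomial (g ∘ suc) (D ∘ suc) I) (sym (sum-filter-∈?-tabulate-suc inside I D)))
  deg-subsetMonomial {suc r} g D (outside ∷ I) =
    trans (deg-subsetMonomial (g ∘ suc) (D ∘ suc) I) (sym (sum-filter-∈?-tabulate-suc outside I D))

  ∣coef-subsetMonomial∣ : ∀ {r} g D (I : Subset r) → ℤ.∣ coef (subsetMonomial g D I) ∣ ≡ 1
  ∣coef-subsetMonomial∣ {zero}  g D []            = refl
  ∣coef-subsetMonomial∣ {suc r} g D (inside  ∷ I) = let c = coef (subsetMonomial (g ∘ suc) (D ∘ suc) I) in
    trans (ℤP.abs-* -1ℤ c) (trans (ℕP.*-identityˡ ℤ.∣ c ∣) (∣coef-subsetMonomial∣ (g ∘ suc) (D ∘ suc) I))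
  ∣coef-subsetMonomial∣ {suc r} g D (outside ∷ I) = let c = coef (subsetMonomial (g ∘ suc) (D ∘ suc) I) in
    trans (ℤP.abs-* 1ℤ c) (trans (ℕP.*-identityˡ ℤ.∣ c ∣) (∣coef-subsetMonomial∣ (g ∘ suc) (D ∘ suc) I))

  countDeg-map : ∀ {A : Set} (f : A → Monomial) k {P : A → Set} (P? : Decidable P) →
                 (∀ x → deg (f x) ≡ k → P x) → (∀ x → P x → deg (f x) ≡ k) →
                 ∀ xs → countDeg k (map f xs) ≡ length (filter P? xs)
  countDeg-map f k P? deg⇒P P⇒deg []       = refl
  countDeg-map f k P? deg⇒P P⇒deg (x ∷ xs) with deg (f x) ℕ.≟ k | P? x
  ... | yes _      | yes _   = cong suc (countDeg-map f k P? deg⇒P P⇒deg xs)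
  ... | no  _      | no  _   = countDeg-map f k P? deg⇒P P⇒deg xs
  ... | yes deg≡k  | no  ¬Px = ⊥-elim (¬Px (deg⇒P x deg≡k))
  ... | no  deg≢k  | yes Px  = ⊥-elim (deg≢k (P⇒deg x Px))

HasPeriod : (ℤ → ℤ) → ℕ → Set
HasPeriod f s = ∀ x → f (x - + s) ≡ f x

period-* : ∀ {f s} → HasPeriod f s → ∀ k → HasPeriod f (k ℕ.* s)
period-* {f}     per zero    x = cong f (ℤP.+-identityʳ x)
period-* {f} {s} per (suc k) x = begin
  f (x - + (s ℕ.+ k ℕ.* s))      ≡⟨ cong f (trans (cong (_-_ x) (ℤP.pos-+ s (k ℕ.* s))) (split x (+ s) _)) ⟩
  f ((x - + (k ℕ.* s)) - + s)    ≡⟨ per _ ⟩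
  f (x - + (k ℕ.* s))            ≡⟨ period-* per k x ⟩
  f x                            ∎
  where
  open ≡-Reasoning
  split : ∀ x a b → x - (a + b) ≡ (x - b) - a
  split = solve-∀

period-cancel : ∀ {f a g} → HasPeriod f a → HasPeriod f (g ℕ.+ a) → HasPeriod f g
period-cancel {f} {a} {g} per-a per-g+a x = begin
  f (x - + g)              ≡⟨ per-a (x - + g) ⟨
  f ((x - + g) - + a)      ≡⟨ cong f (trans (join x (+ g) (+ a)) (cong (_-_ x) (sym (ℤP.pos-+ g a)))) ⟩
  f (x - + (g ℕ.+ a))      ≡⟨ per-g+a x ⟩
  f x                      ∎
  where
  open ≡-Reasoning
  join : ∀ x g a → (x - g) - a ≡ x - (g + a)
  join = solve-∀

period-∣ : ∀ {f g s} → HasPeriod f g → g ℕD.∣ s → HasPeriod f s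
period-∣ per (ℕD.divides q refl) = period-* per q

period-gcd : ∀ {f a b} → HasPeriod f a → HasPeriod f b → HasPeriod f (gcd a b)
period-gcd {f} {a} {b} per-a per-b with Bézout.identity (gcd-GCD a b)
... | Bézout.+- x y eq = period-cancel (period-* per-b y) (subst (HasPeriod f) (sym eq) (period-* per-a x))
... | Bézout.-+ x y eq = period-cancel (period-* per-a x) (subst (HasPeriod f) (sym eq) (period-* per-b y))

prime-factor : ∀ q → 1 ℕ.< q → Σ[ p ∈ ℕ ] (Prime p × p ℕD.∣ q)
prime-factor q@(suc _) 1<q with factorise q
... | record { factors = [] ; isFactorisation = q≡1 } = ⊥-elim (ℕP.<-irrefl (sym q≡1) 1<q)
... | record { factors = p ∷ ps ; isFactorisation = q≡p*ps ; factorsPrime = p-prime ∷ _ } =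
  p , p-prime , subst (p ℕD.∣_) (sym q≡p*ps) (ℕD.m∣m*n _)

proper-divisor-∣-prime-cofactor : ∀ {N G} → G ℕD.∣ N → G ℕ.< N → Σ[ p ∈ ℕ ] Σ[ s ∈ ℕ ] (Prime p × N ≡ s ℕ.* p × G ℕD.∣ s)
proper-divisor-∣-prime-cofactor {N} {G} G∣N@(ℕD.divides q N≡q*G) G<N with prime-factor q (ℕD.quotient>1 G∣N G<N)
... | p , p-prime , ℕD.divides q′ q≡q′*p = p , q′ ℕ.* G , p-prime , N≡[q′*G]*p , ℕD.n∣m*n q′
  where
  N≡[q′*G]*p : N ≡ q′ ℕ.* G ℕ.* p
  N≡[q′*G]*p = trans N≡q*G (trans (cong (ℕ._* G) q≡q′*p) (swap q′ p G))
    where swap : ∀ a b c → a ℕ.* b ℕ.* c ≡ a ℕ.* c ℕ.* b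
          swap = ℕSolver.solve-∀

module Cyclotomic (N : ℕ) {{N≢0 : NonZero N}} where

  open GroupRingPolynomials N
  open SubsetExpansion N using (∏1-u^Y^)

  factor≢0ˡ : ∀ a b → a ℕ.* b ≡ N → NonZero a
  factor≢0ˡ a b a*b≡N = ℕP.m*n≢0⇒m≢0 a {{subst NonZero (sym a*b≡N) N≢0}}

  factor≢0ʳ : ∀ a b → a ℕ.* b ≡ N → NonZero b
  factor≢0ʳ a b a*b≡N = ℕP.m*n≢0⇒n≢0 a {{subst NonZero (sym a*b≡N) N≢0}}

  χ-∣ : ∀ {z} → + N ∣ z → χ z ≡ 1ℤ
  χ-∣ {z} N∣z with + N ∣? z
  ... | yes _   = refl
  ... | no  N∤z = ⊥-elim (N∤z N∣z)

  χ-≢0 : ∀ z → χ z ≢ 0ℤ → + N ∣ z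
  χ-≢0 z χz≢0 with + N ∣? z
  ... | yes N∣z = N∣z
  ... | no  _   = ⊥-elim (χz≢0 refl)

  ∣χ∣≤1 : ∀ z → ℤ.∣ χ z ∣ ℕ.≤ 1
  ∣χ∣≤1 z with + N ∣? z
  ... | yes _ = ℕP.≤-refl
  ... | no  _ = z≤n

  act-1-u^Y^0 : ∀ s f x → act (1-u^ s Y^ 0) f x ≡ f x - f (x - s)
  act-1-u^Y^0 s f x = cong₂ _+_ (trans (ℤP.*-identityˡ _) (cong f (ℤP.+-identityʳ x))) (trans (ℤP.+-identityʳ _) (ℤP.-1*i≡-i _))

  record Peaked (f : ℤ → ℤ) (P : ℕ) : Set where
    field
      at-0    : f 0ℤ ≡ 1ℤ
      bounded : ∀ x → ℤ.∣ f x ∣ ℕ.≤ 1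
      support : ∀ x → f x ≢ 0ℤ → + N ∣ + P * x

  module _ {f : ℤ → ℤ} {P p s : ℕ} (N≡s*p : N ≡ s ℕ.* p) (p∤P : ¬ p ℕD.∣ P)
           (f-support : ∀ x → f x ≢ 0ℤ → + N ∣ + P * x) where

    -- The support of f lies in the subgroup generated by the N/q for the primes q ∣ P; it cannot meet its translate by N/p.
    support-disjoint-translate : ∀ x → f x ≢ 0ℤ → f (x - + s) ≢ 0ℤ → ⊥
    support-disjoint-translate x fx≢0 fx-s≢0 = p∤P (ℕD.*-cancelʳ-∣ s {{factor≢0ˡ s p (sym N≡s*p)}} p*s∣P*s)
      where
      difference : + P * x - + P * (x - + s) ≡ + (P ℕ.* s)
      difference = trans (cancel (+ P) x (+ s)) (sym (ℤP.pos-* P s))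
        where cancel : ∀ P x s → P * x - P * (x - s) ≡ P * s
              cancel = solve-∀
      p*s∣P*s : p ℕ.* s ℕD.∣ P ℕ.* s
      p*s∣P*s = subst₂ ℕD._∣_ (trans N≡s*p (ℕP.*-comm s p)) refl
                  (∣⇒∣ᵤ (subst (+ N ∣_) difference (∣m∣n⇒∣m-n (f-support x fx≢0) (f-support _ fx-s≢0))))

    pos-*-assoc : ∀ p P x → + p * (+ P * x) ≡ + (p ℕ.* P) * x
    pos-*-assoc p P x = trans (sym (ℤP.*-assoc (+ p) (+ P) x)) (cong (_* x) (sym (ℤP.pos-* p P)))

    support-step : ∀ x → f x - f (x - + s) ≢ 0ℤ → + N ∣ + (p ℕ.* P) * x
    support-step x diff≢0 with f x ℤ.≟ 0ℤ
    ... | no fx≢0  = subst (+ N ∣_) (pos-*-assoc p P x) (∣n⇒∣m*n (+ p) (f-support x fx≢0))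
    ... | yes fx≡0 = subst (+ N ∣_) regroup
                       (∣m∣n⇒∣m+n (∣n⇒∣m*n (+ p) (f-support _ fx-s≢0)) (∣n⇒∣m*n (+ P) ∣-refl))
      where
      fx-s≢0 : f (x - + s) ≢ 0ℤ
      fx-s≢0 fx-s≡0 = diff≢0 (cong₂ _-_ fx≡0 fx-s≡0)
      regroup : + p * (+ P * (x - + s)) + + P * + N ≡ + (p ℕ.* P) * x
      regroup = begin
        + p * (+ P * (x - + s)) + + P * + N           ≡⟨ cong (λ n → + p * (+ P * (x - + s)) + + P * n) (trans (cong +_ N≡s*p) (ℤP.pos-* s p)) ⟩
        + p * (+ P * (x - + s)) + + P * (+ s * + p)   ≡⟨ expand (+ p) (+ P) x (+ s) ⟩
        + p * (+ P * x)                                ≡⟨ pos-*-assoc p P x ⟩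
        + (p ℕ.* P) * x                                ∎
        where
        open ≡-Reasoning
        expand : ∀ p P x s → p * (P * (x - s)) + P * (s * p) ≡ p * (P * x)
        expand = solve-∀

  ∣0-i∣≡∣i∣ : ∀ i → ℤ.∣ 0ℤ - i ∣ ≡ ℤ.∣ i ∣
  ∣0-i∣≡∣i∣ i = trans (cong ℤ.∣_∣ (ℤP.+-identityˡ (- i))) (ℤP.∣-i∣≡∣i∣ i)

  Peaked-step : ∀ {f P p s} → N ≡ s ℕ.* p → ¬ p ℕD.∣ P → Peaked f P → Peaked (λ x → f x - f (x - + s)) (p ℕ.* P)
  Peaked-step {f} {P} {p} {s} N≡s*p p∤P f-peaked = record
    { at-0    = at-0′
    ; bounded = bounded′
    ; support = support-step N≡s*p p∤P support
    }
    where
    open Peaked f-peaked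
    disjoint = support-disjoint-translate N≡s*p p∤P support
    at-0′ : f 0ℤ - f (0ℤ - + s) ≡ 1ℤ
    at-0′ with f (0ℤ - + s) ℤ.≟ 0ℤ
    ... | yes f-s≡0 = cong₂ _-_ at-0 f-s≡0
    ... | no  f-s≢0 = ⊥-elim (disjoint 0ℤ (λ f0≡0 → 1≢0 (trans (sym at-0) f0≡0)) f-s≢0)
      where 1≢0 : 1ℤ ≢ 0ℤ
            1≢0 ()
    bounded′ : ∀ x → ℤ.∣ f x - f (x - + s) ∣ ℕ.≤ 1
    bounded′ x with f x ℤ.≟ 0ℤ | f (x - + s) ℤ.≟ 0ℤ
    ... | yes fx≡0 | _          rewrite fx≡0   = subst (ℕ._≤ 1) (sym (∣0-i∣≡∣i∣ (f (x - + s)))) (bounded (x - + s))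
    ... | no  _    | yes fx-s≡0 rewrite fx-s≡0 = subst (ℕ._≤ 1) (sym (cong ℤ.∣_∣ (ℤP.+-identityʳ (f x)))) (bounded x)
    ... | no  fx≢0 | no fx-s≢0 = ⊥-elim (disjoint x fx≢0 fx-s≢0)

  Peaked-cong : ∀ {f g P} → (∀ x → f x ≡ g x) → Peaked f P → Peaked g P
  Peaked-cong {f} {g} f≡g f-peaked = record
    { at-0    = trans (sym (f≡g 0ℤ)) at-0
    ; bounded = λ x → subst (λ z → ℤ.∣ z ∣ ℕ.≤ 1) (f≡g x) (bounded x)
    ; support = λ x gx≢0 → support x (λ fx≡0 → gx≢0 (trans (sym (f≡g x)) fx≡0))
    }
    where open Peaked f-peaked

  annihilatorBelow : ℕ → Poly
  annihilatorBelow zero    = 1ₚ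
  annihilatorBelow (suc r) with prime? r | r ℕD.∣? N
  ... | yes _ | yes (ℕD.divides s _) = 1-u^ + s Y^ 0 *ₚ annihilatorBelow r
  ... | yes _ | no  _                = annihilatorBelow r
  ... | no  _ | _                    = annihilatorBelow r

  radicalBelow : ℕ → ℕ
  radicalBelow zero    = 1
  radicalBelow (suc r) with prime? r | r ℕD.∣? N
  ... | yes _ | yes _ = r ℕ.* radicalBelow r
  ... | yes _ | no  _ = radicalBelow r
  ... | no  _ | _     = radicalBelow r

  Deg≤0-1-u^Y^0 : ∀ s → Deg≤ 0 (1-u^ s Y^ 0)
  Deg≤0-1-u^Y^0 s = z≤n ∷ z≤n ∷ []

  Deg≤0-annihilatorBelow : ∀ r → Deg≤ 0 (annihilatorBelow r)
  Deg≤0-annihilatorBelow zero    = z≤n ∷ []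
  Deg≤0-annihilatorBelow (suc r) with prime? r | r ℕD.∣? N
  ... | yes _ | yes (ℕD.divides s _) = Deg≤-*ₚ (Deg≤0-1-u^Y^0 (+ s)) (Deg≤0-annihilatorBelow r)
  ... | yes _ | no  _                = Deg≤0-annihilatorBelow r
  ... | no  _ | _                    = Deg≤0-annihilatorBelow r

  radicalBelow-coprime : ∀ r {p} → Prime p → r ℕ.≤ p → ¬ p ℕD.∣ radicalBelow r
  radicalBelow-coprime zero    {p} p-prime _ p∣1 =
    ℕP.<-irrefl refl (ℕP.<-≤-trans (ℕ.nonTrivial⇒n>1 p {{prime⇒nonTrivial p-prime}}) (ℕD.∣⇒≤ p∣1))
  radicalBelow-coprime (suc r) {p} p-prime r<p p∣R with prime? r | r ℕD.∣? N
  ... | yes r-prime | yes _ with euclidsLemma r (radicalBelow r) p-prime p∣R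
  ...   | inj₁ p∣r  = ℕP.<-irrefl refl (ℕP.<-≤-trans r<p (ℕD.∣⇒≤ {{prime⇒nonZero r-prime}} p∣r))
  ...   | inj₂ p∣R′ = radicalBelow-coprime r p-prime (ℕP.<⇒≤ r<p) p∣R′
  radicalBelow-coprime (suc r) p-prime r<p p∣R | yes _ | no _ = radicalBelow-coprime r p-prime (ℕP.<⇒≤ r<p) p∣R
  radicalBelow-coprime (suc r) p-prime r<p p∣R | no  _ | _    = radicalBelow-coprime r p-prime (ℕP.<⇒≤ r<p) p∣R

  coeff-1ₚ-0 : ∀ x → coeff 1ₚ 0 x ≡ χ (- x)
  coeff-1ₚ-0 x = trans (ℤP.+-identityʳ _) (trans (ℤP.*-identityˡ _) (cong χ (ℤP.+-identityˡ (- x))))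

  1ₚ-peaked : Peaked (coeff 1ₚ 0) 1
  1ₚ-peaked = record
    { at-0    = trans (coeff-1ₚ-0 0ℤ) (χ-∣ (divides 0ℤ refl))
    ; bounded = λ x → subst (λ z → ℤ.∣ z ∣ ℕ.≤ 1) (sym (coeff-1ₚ-0 x)) (∣χ∣≤1 (- x))
    ; support = λ x c≢0 → subst (+ N ∣_) (trans (ℤP.neg-involutive x) (sym (ℤP.*-identityˡ x)))
                                (∣m⇒∣-m (χ-≢0 (- x) (λ χ≡0 → c≢0 (trans (coeff-1ₚ-0 x) χ≡0))))
    }

  annihilatorBelow-peaked : ∀ r → Peaked (coeff (annihilatorBelow r) 0) (radicalBelow r)
  annihilatorBelow-peaked zero    = 1ₚ-peaked
  annihilatorBelow-peaked (suc r) with prime? r | r ℕD.∣? N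
  ... | yes r-prime | yes (ℕD.divides s N≡s*r) =
    Peaked-cong (λ x → sym (trans (coeff-*ₚ-deg0 (Deg≤0-1-u^Y^0 (+ s)) (annihilatorBelow r) 0 x) (act-1-u^Y^0 (+ s) (coeff (annihilatorBelow r) 0) x)))
                (Peaked-step N≡s*r (radicalBelow-coprime r r-prime ℕP.≤-refl) (annihilatorBelow-peaked r))
  ... | yes _ | no  _ = annihilatorBelow-peaked r
  ... | no  _ | _     = annihilatorBelow-peaked r

  act-period : ∀ P {f s} → HasPeriod f s → HasPeriod (act P f) s
  act-period P {f} {s} per x = trans (sym (act-shift P f (+ s) x)) (act-cong P per x)

  annihilatorBelow-kills : ∀ {p s f} → Prime p → N ≡ s ℕ.* p → HasPeriod f s →
                           ∀ r → p ℕ.< r → ∀ x → act (annihilatorBelow r) f x ≡ 0ℤ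
  annihilatorBelow-kills {p} {s} {f} p-prime N≡s*p per (suc r) p<1+r x
    with prime? r | r ℕD.∣? N | ℕP.m≤n⇒m<n∨m≡n (ℕP.≤-pred p<1+r)
  ... | yes _ | yes (ℕD.divides s′ _) | inj₁ p<r =
    trans (act-*ₚ (1-u^ + s′ Y^ 0) (annihilatorBelow r) f x) (act-zero (1-u^ + s′ Y^ 0) (annihilatorBelow-kills p-prime N≡s*p per r p<r) x)
  ... | yes _ | yes (ℕD.divides s′ N≡s′*p) | inj₂ refl =
    trans (act-*ₚ (1-u^ + s′ Y^ 0) (annihilatorBelow r) f x)
          (trans (act-1-u^Y^0 (+ s′) g x) (ℤP.i≡j⇒i-j≡0 (sym (subst (HasPeriod g) s≡s′ g-period x))))
    where
    g = act (annihilatorBelow p) f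
    g-period : HasPeriod g s
    g-period = act-period (annihilatorBelow p) per
    s≡s′ : s ≡ s′
    s≡s′ = ℕP.*-cancelʳ-≡ s s′ p {{prime⇒nonZero p-prime}} (trans (sym N≡s*p) N≡s′*p)
  ... | yes _ | no  p∤N | inj₂ refl = ⊥-elim (p∤N (ℕD.divides s N≡s*p))
  ... | yes _ | no  _   | inj₁ p<r  = annihilatorBelow-kills p-prime N≡s*p per r p<r x
  ... | no  r-not-prime | _ | inj₂ refl = ⊥-elim (r-not-prime p-prime)
  ... | no  _ | _       | inj₁ p<r  = annihilatorBelow-kills p-prime N≡s*p per r p<r x

  -- E = ∏ (1 − u^{N/p}) over the primes p ∣ N. Multiplication by E kills every non-primitive character of ℤ/N,
  -- so E·X ≈ₚ E·X′ says that X and X′ agree in ℤ[ζ][Y], ζ a primitive N-th root of unity.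
  E : Poly
  E = annihilatorBelow (suc N)

  Deg≤0-E : Deg≤ 0 E
  Deg≤0-E = Deg≤0-annihilatorBelow (suc N)

  E-peaked : Peaked (coeff E 0) (radicalBelow (suc N))
  E-peaked = annihilatorBelow-peaked (suc N)

  E-kills : ∀ {p s f} → Prime p → N ≡ s ℕ.* p → HasPeriod f s → ∀ x → act E f x ≡ 0ℤ
  E-kills {s = s} p-prime N≡s*p per = annihilatorBelow-kills p-prime N≡s*p per (suc N) (s≤s (ℕD.∣⇒≤ (ℕD.divides s N≡s*p)))

  E-kills-proper-period : ∀ {f a} → HasPeriod f a → HasPeriod f N → 0 ℕ.< a → a ℕ.< N → ∀ x → act E f x ≡ 0ℤ
  E-kills-proper-period {f} {a} per-a per-N 0<a a<N
    with proper-divisor-∣-prime-cofactor (gcd[m,n]∣n a N) (ℕP.≤-<-trans (ℕD.∣⇒≤ {{ℕ.>-nonZero 0<a}} (gcd[m,n]∣m a N)) a<N)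
  ... | p , s , p-prime , N≡s*p , gcd∣s = E-kills p-prime N≡s*p (period-∣ (period-gcd per-a per-N) gcd∣s)

  E-half-turn : ∀ {f h} → N ≡ h ℕ.+ h → HasPeriod f N → ∀ x → act E (λ y → f (y - + h)) x ≡ - act E f x
  E-half-turn {f} {h} N≡h+h per-N x =
    inverseˡ-unique _ _ (trans (sym (act-+ E (λ y → f (y - + h)) f x)) (E-kills prime[2] N≡h*2 g-period x))
    where
    open import Algebra.Properties.AbelianGroup ℤP.+-0-abelianGroup using (inverseˡ-unique)
    N≡h*2 : N ≡ h ℕ.* 2
    N≡h*2 = trans N≡h+h (trans (cong (h ℕ.+_) (sym (ℕP.+-identityʳ h))) (ℕP.*-comm 2 h))
    g-period : HasPeriod (λ y → f (y - + h) + f y) h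
    g-period y = begin
      f ((y - + h) - + h) + f (y - + h) ≡⟨ cong (λ z → f z + f (y - + h)) (trans (join y (+ h)) (cong (λ n → y - + n) (sym N≡h+h))) ⟩
      f (y - + N) + f (y - + h)         ≡⟨ cong (_+ f (y - + h)) (per-N y) ⟩
      f y + f (y - + h)                 ≡⟨ ℤP.+-comm (f y) _ ⟩
      f (y - + h) + f y                 ∎
      where
      open ≡-Reasoning
      join : ∀ y h → (y - h) - h ≡ y - (h + h)
      join = solve-∀

  coeffₘ-period-N : ∀ t e → HasPeriod (coeffₘ t e) N
  coeffₘ-period-N (mono c d g) e x with d ℕ.≟ e
  ... | yes _ = cong (c *_) (χ-cong (divides 1ℤ (shift g x (+ N))))
    where shift : ∀ g x N → (g - (x - N)) - (g - x) ≡ 1ℤ * N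
          shift = solve-∀
  ... | no  _ = refl

  coeff-period-N : ∀ p e → HasPeriod (coeff p e) N
  coeff-period-N p e x = ∑-cong (λ t → coeffₘ-period-N t e x) p

  coeff-1-u^Y^-0 : ∀ g {d} → 0 ℕ.< d → ∀ y → coeff (1-u^ g Y^ d) 0 y ≡ coeff 1ₚ 0 y
  coeff-1-u^Y^-0 g {d} 0<d y = cong (_+_ (coeffₘ (mono 1ℤ 0 0ℤ) 0 y)) (cong (_+ 0ℤ) (coeffₘ-deg≢ (mono -1ℤ d g) y d≢0))
    where d≢0 : d ≢ 0
          d≢0 d≡0 = ℕP.<-irrefl (sym d≡0) 0<d

  coeff-1-u^Y^-other : ∀ g d {k} → 0 ℕ.< k → k ≢ d → ∀ y → coeff (1-u^ g Y^ d) k y ≡ 0ℤ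
  coeff-1-u^Y^-other g d {k} 0<k k≢d y =
    cong₂ _+_ (coeffₘ-deg≢ (mono 1ℤ 0 0ℤ) y (λ 0≡k → ℕP.<-irrefl 0≡k 0<k)) (cong (_+ 0ℤ) (coeffₘ-deg≢ (mono -1ℤ d g) y (k≢d ∘ sym)))

  coeff-1-u^Y^-top : ∀ g {d} → 0 ℕ.< d → ∀ y → coeff (1-u^ g Y^ d) d y ≡ - χ (g - y)
  coeff-1-u^Y^-top g {d} 0<d y = begin
    coeffₘ (mono 1ℤ 0 0ℤ) d y + (coeffₘ (mono -1ℤ d g) d y + 0ℤ)
      ≡⟨ cong₂ _+_ (coeffₘ-deg≢ (mono 1ℤ 0 0ℤ) y (λ 0≡d → ℕP.<-irrefl 0≡d 0<d)) (ℤP.+-identityʳ (coeffₘ (mono -1ℤ d g) d y)) ⟩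
    0ℤ + coeffₘ (mono -1ℤ d g) d y     ≡⟨ ℤP.+-identityˡ (coeffₘ (mono -1ℤ d g) d y) ⟩
    coeffₘ (mono -1ℤ d g) d y          ≡⟨ coeffₘ-deg≡ (mono -1ℤ d g) y refl ⟩
    -1ℤ * χ (g - y)                    ≡⟨ ℤP.-1*i≡-i _ ⟩
    - χ (g - y)                        ∎
    where open ≡-Reasoning

  coeff-∏1-u^Y-progression-top : ∀ b n d y →
    coeff (∏1-u^ progression b n d Y) d y ≡ -1ℤ ℤ.^ d * χ ((b * + d + + (n ℕ.* triangular d)) - y)
  coeff-∏1-u^Y-progression-top b n d y =
    trans (subst (λ ℓ → coeff (∏1-u^ progression b n d Y) ℓ y ≡ -1ℤ ℤ.^ ℓ * χ (∑ (λ y → y) (progression b n d) - y))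
                 (length-progression b n d) (coeff-∏1-u^Y-top (progression b n d) y))
          (cong (λ z → -1ℤ ℤ.^ d * χ (z - y)) (∑-progression b n d))

  N∣n*[d*j] : ∀ n d j {t} → n ℕ.* d ≡ N → t ≡ d ℕ.* j → N ℕD.∣ n ℕ.* t
  N∣n*[d*j] n d j nd refl = ℕD.divides j (trans (sym (ℕP.*-assoc n d j)) (trans (cong (ℕ._* j) nd) (ℕP.*-comm N j)))

  -- The top coefficient is (−1)^d u^{bd + n·T(d)}, and n·T(d) is ≡ 0 (mod N) for odd d and ≡ N/2 for even d;
  -- E identifies u^{N/2} with −1.
  E-top-coefficient : ∀ b n d → n ℕ.* d ≡ N → ∀ x →
    act E (coeff (∏1-u^ progression b n d Y) d) x ≡ act E (λ y → - χ (b * + d - y)) x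
  E-top-coefficient b n d nd x with triangular-parity d
  ... | inj₁ (j , refl , T≡d*j) = act-cong E (λ y → trans (coeff-∏1-u^Y-progression-top b n d y) (odd y)) x
    where
    N∣n*T : N ℕD.∣ n ℕ.* triangular d
    N∣n*T = N∣n*[d*j] n d j nd T≡d*j
    odd : ∀ y → -1ℤ ℤ.^ d * χ ((b * + d + + (n ℕ.* triangular d)) - y) ≡ - χ (b * + d - y)
    odd y = trans (cong₂ _*_ (-1^-odd j) (χ-cong N∣difference)) (ℤP.-1*i≡-i _)
      where
      cancel : ∀ B t y → ((B + t) - y) - (B - y) ≡ t
      cancel = solve-∀
      N∣difference = subst (+ N ∣_) (sym (cancel (b * + d) _ y)) (∣ᵤ⇒∣ {i = + (n ℕ.* triangular d)} N∣n*T)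
  ... | inj₂ (j , refl , T+j≡d*j) = begin
    act E (coeff (∏1-u^ progression b n d Y) d) x  ≡⟨ act-cong E (λ y → trans (coeff-∏1-u^Y-progression-top b n d y) (even y)) x ⟩
    act E (λ y → f (y - + h)) x                    ≡⟨ E-half-turn N≡h+h f-period x ⟩
    - act E f x                                    ≡⟨ act-neg E f x ⟨
    act E (λ y → - f y) x                          ∎
    where
    open ≡-Reasoning
    h = n ℕ.* j
    f : ℤ → ℤ
    f y = χ (b * + d - y)
    N≡h+h : N ≡ h ℕ.+ h
    N≡h+h = trans (sym nd) (ℕP.*-distribˡ-+ n j j)
    f-period : HasPeriod f N
    f-period y = χ-cong (divides 1ℤ (shift (b * + d) y (+ N)))
      where shift : ∀ B y N → (B - (y - N)) - (B - y) ≡ 1ℤ * N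
            shift = solve-∀
    N∣n*[T+j] : N ℕD.∣ n ℕ.* (triangular d ℕ.+ j)
    N∣n*[T+j] = N∣n*[d*j] n d j nd T+j≡d*j
    difference : ∀ y → ((b * + d + + (n ℕ.* triangular d)) - y) - (b * + d - (y - + h)) ≡ + (n ℕ.* (triangular d ℕ.+ j)) - + N
    difference y = trans (regroup (b * + d) (+ (n ℕ.* triangular d)) y (+ h)) (cong₂ _-_ t+h h+h)
      where
      regroup : ∀ B t y h → ((B + t) - y) - (B - (y - h)) ≡ (t + h) - (h + h)
      regroup = solve-∀
      t+h : + (n ℕ.* triangular d) + + h ≡ + (n ℕ.* (triangular d ℕ.+ j))
      t+h = trans (sym (ℤP.pos-+ _ h)) (cong +_ (sym (ℕP.*-distribˡ-+ n (triangular d) j)))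
      h+h : + h + + h ≡ + N
      h+h = trans (sym (ℤP.pos-+ h h)) (cong +_ (sym N≡h+h))
    even : ∀ y → -1ℤ ℤ.^ d * χ ((b * + d + + (n ℕ.* triangular d)) - y) ≡ f (y - + h)
    even y = trans (cong₂ _*_ (-1^-even j) (χ-cong N∣difference)) (ℤP.*-identityˡ _)
      where N∣difference = subst (+ N ∣_) (sym (difference y)) (∣m∣n⇒∣m-n (∣ᵤ⇒∣ {i = + (n ℕ.* (triangular d ℕ.+ j))} N∣n*[T+j]) ∣-refl)

  E-cyclotomic : ∀ b n d → n ℕ.* d ≡ N → E *ₚ ∏1-u^ progression b n d Y ≈ₚ E *ₚ 1-u^ (b * + d) Y^ d
  E-cyclotomic b n d nd = mk≈ₚ λ k x →
    trans (coeff-*ₚ-deg0 Deg≤0-E F k x) (trans (same-action k x) (sym (coeff-*ₚ-deg0 Deg≤0-E B k x)))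
    where
    F = ∏1-u^ progression b n d Y
    B = 1-u^ (b * + d) Y^ d
    instance
      n≢0 = factor≢0ˡ n d nd
      d≢0 = factor≢0ʳ n d nd
    0<d : 0 ℕ.< d
    0<d = ℕ.>-nonZero⁻¹ d
    Deg≤-F : Deg≤ d F
    Deg≤-F = subst (λ ℓ → Deg≤ ℓ F) (length-progression b n d) (Deg≤-∏1-u^Y (progression b n d))
    rotation-period : ∀ k → HasPeriod (coeff F k) (n ℕ.* k)
    rotation-period k y = begin
      coeff F k (y - + (n ℕ.* k))            ≡⟨ cong (λ z → coeff F k (y - z)) (ℤP.pos-* n k) ⟩
      coeff F k (y - + n * + k)              ≡⟨ coeff-twist (+ n) F k y ⟨
      coeff (map (twist (+ n)) F) k y        ≡⟨ coeff-≡ (∏1-u^Y-progression-rotation b n d nd) k y ⟩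
      coeff F k y                            ∎
      where open ≡-Reasoning
    same-action : ∀ k x → act E (coeff F k) x ≡ act E (coeff B k) x
    same-action zero x = act-cong E (λ y → trans (coeff-∏1-u^Y-0 (progression b n d) y) (sym (coeff-1-u^Y^-0 (b * + d) 0<d y))) x
    same-action k@(suc _) x with ℕP.<-cmp k d
    ... | tri< k<d _ _ =
      trans (E-kills-proper-period (rotation-period k) (coeff-period-N F k) (ℕP.*-mono-< (ℕ.>-nonZero⁻¹ n) (s≤s z≤n))
                                   (subst (n ℕ.* k ℕ.<_) nd (ℕP.*-monoʳ-< n k<d)) x)
            (sym (act-zero E (λ y → coeff-1-u^Y^-other (b * + d) d (s≤s z≤n) (ℕP.<⇒≢ k<d) y) x))
    ... | tri≈ _ refl _ = trans (E-top-coefficient b n d nd x) (act-cong E (λ y → sym (coeff-1-u^Y^-top (b * + d) 0<d y)) x)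
    ... | tri> _ _ d<k =
      trans (act-zero E (λ y → coeff-deg> Deg≤-F y d<k) x)
            (sym (act-zero E (λ y → coeff-1-u^Y^-other (b * + d) d (s≤s z≤n) (ℕP.>⇒≢ d<k) y) x))

  residue : ℤ → ℕ
  residue y = y %ℕ N

  residue<N : ∀ y → residue y ℕ.< N
  residue<N y = n%ℕd<d y N

  N∣y-residue : ∀ y → + N ∣ y - + residue y
  N∣y-residue y = divides (y /ℕ N) (trans (cong (_- + residue y) (a≡a%ℕn+[a/ℕn]*n y N)) (cancel (+ residue y) _))
    where cancel : ∀ r q → (r + q) - r ≡ q
          cancel = solve-∀

  residues-distinct : ∀ {r₁ r₂} → r₁ ℕ.< r₂ → r₂ ℕ.< N → ¬ (+ N ∣ + r₂ - + r₁)
  residues-distinct {r₁} {r₂} r₁<r₂ r₂<N N∣r₂-r₁ =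
    ℕD.>⇒∤ {{ℕ.>-nonZero (ℕP.m<n⇒0<n∸m r₁<r₂)}} (ℕP.≤-<-trans (ℕP.m∸n≤m r₂ r₁) r₂<N)
           (∣⇒∣ᵤ (subst (+ N ∣_) (trans (ℤP.[+m]-[+n]≡m⊖n r₂ r₁) (ℤP.⊖-≥ (ℕP.<⇒≤ r₁<r₂))) N∣r₂-r₁))

  residue-unique : ∀ {y z} → z ℕ.< N → + N ∣ y - + z → z ≡ residue y
  residue-unique {y} {z} z<N N∣y-z with ℕP.<-cmp z (residue y)
  ... | tri≈ _ z≡r _ = z≡r
  ... | tri< z<r _ _ = ⊥-elim (residues-distinct z<r (residue<N y) (subst (+ N ∣_) (cancel y _ _) (∣m∣n⇒∣m-n N∣y-z (N∣y-residue y))))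
    where cancel : ∀ y z r → (y - z) - (y - r) ≡ r - z
          cancel = solve-∀
  ... | tri> _ _ r<z = ⊥-elim (residues-distinct r<z z<N (subst (+ N ∣_) (cancel y _ _) (∣m∣n⇒∣m-n (N∣y-residue y) N∣y-z)))
    where cancel : ∀ y r z → (y - r) - (y - z) ≡ z - r
          cancel = solve-∀

  δ : ℤ → ℕ → ℕ
  δ y z with + N ∣? y - + z
  ... | yes _ = 1
  ... | no  _ = 0

  δ-residue : ∀ y → δ y (residue y) ≡ 1
  δ-residue y with + N ∣? y - + residue y
  ... | yes _   = refl
  ... | no  N∤ = ⊥-elim (N∤ (N∣y-residue y))

  δ-other : ∀ y {z} → z ℕ.< N → z ≢ residue y → δ y z ≡ 0
  δ-other y {z} z<N z≢r with + N ∣? y - + z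
  ... | yes N∣ = ⊥-elim (z≢r (residue-unique {y} z<N N∣))
  ... | no  _  = refl

  occurrences : List ℤ → ℕ → ℕ
  occurrences []       z = 0
  occurrences (y ∷ ys) z = δ y z ℕ.+ occurrences ys z

  multiset-δ-≤ : ∀ y r → r ℕ.≤ residue y → multiset (δ y) r ≡ []
  multiset-δ-≤ y zero    _   = refl
  multiset-δ-≤ y (suc r) r<res
    rewrite δ-other y (ℕP.<-≤-trans r<res (ℕP.<⇒≤ (residue<N y))) (ℕP.<⇒≢ r<res) = multiset-δ-≤ y r (ℕP.<⇒≤ r<res)

  multiset-δ : ∀ y r → residue y ℕ.< r → r ℕ.≤ N → multiset (δ y) r ≡ + residue y ∷ []
  multiset-δ y (suc r) res<1+r 1+r≤N with ℕP.m≤n⇒m<n∨m≡n (ℕP.≤-pred res<1+r)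
  ... | inj₁ res<r  rewrite δ-other y 1+r≤N (ℕP.>⇒≢ res<r) = multiset-δ y r res<r (ℕP.<⇒≤ 1+r≤N)
  ... | inj₂ refl   rewrite δ-residue y = cong (+ residue y ∷_) (multiset-δ-≤ y (residue y) ℕP.≤-refl)

  ∏1-u^Y-normal-form : ∀ ys → ∏1-u^ ys Y ≈ₚ ∏1-u^ multiset (occurrences ys) N Y
  ∏1-u^Y-normal-form []       = ≈ₚ-reflexive (cong ∏1-u^_Y (sym (multiset-zero N)))
  ∏1-u^Y-normal-form (y ∷ ys) = begin
    1-u^ y Y^ 1 *ₚ ∏1-u^ ys Y                                           ≈⟨ *ₚ-cong single (∏1-u^Y-normal-form ys) ⟩
    ∏1-u^ multiset (δ y) N Y *ₚ ∏1-u^ multiset (occurrences ys) N Y     ≈⟨ ∏1-u^Y-multiset-+ (δ y) (occurrences ys) N ⟨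
    ∏1-u^ multiset (occurrences (y ∷ ys)) N Y                           ∎
    where
    open import Relation.Binary.Reasoning.Setoid ≈ₚ-setoid
    single : 1-u^ y Y^ 1 ≈ₚ ∏1-u^ multiset (δ y) N Y
    single = begin
      1-u^ y Y^ 1                       ≈⟨ 1-u^Y^-cong 1 (N∣y-residue y) ⟩
      1-u^ + residue y Y^ 1             ≈⟨ *ₚ-identityʳ (1-u^ + residue y Y^ 1) ⟨
      ∏1-u^ (+ residue y ∷ []) Y        ≡⟨ cong ∏1-u^_Y (multiset-δ y N (residue<N y) ℕP.≤-refl) ⟨
      ∏1-u^ multiset (δ y) N Y          ∎

  length-multiset-occurrences : ∀ ys → length (multiset (occurrences ys) N) ≡ length ys
  length-multiset-occurrences []       = cong length (multiset-zero N)
  length-multiset-occurrences (y ∷ ys) =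
    trans (length-multiset-+ (δ y) (occurrences ys) N)
          (cong₂ ℕ._+_ (cong length (multiset-δ y N (residue<N y) ℕP.≤-refl)) (length-multiset-occurrences ys))

  occurrences-++ : ∀ xs ys z → occurrences (xs ++ ys) z ≡ occurrences xs z ℕ.+ occurrences ys z
  occurrences-++ []       ys z = refl
  occurrences-++ (x ∷ xs) ys z = trans (cong (δ x z ℕ.+_) (occurrences-++ xs ys z)) (sym (ℕP.+-assoc (δ x z) _ _))

  δ-∣ : ∀ {y z} → + N ∣ y - + z → δ y z ≡ 1
  δ-∣ {y} {z} N∣ with + N ∣? y - + z
  ... | yes _  = refl
  ... | no  N∤ = ⊥-elim (N∤ N∣)

  δ-∤ : ∀ {y z} → ¬ (+ N ∣ y - + z) → δ y z ≡ 0
  δ-∤ {y} {z} N∤ with + N ∣? y - + z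
  ... | yes N∣ = ⊥-elim (N∤ N∣)
  ... | no  _  = refl

  progression-head : ∀ b n → b + + (n ℕ.* 0) ≡ b
  progression-head b n = trans (cong (λ k → b + + k) (ℕP.*-zeroʳ n)) (ℤP.+-identityʳ b)

  occurrences-progression-none : ∀ b n d z → (∀ i → i ℕ.< d → ¬ (+ N ∣ (b + + (n ℕ.* i)) - + z)) →
                                 occurrences (progression b n d) z ≡ 0
  occurrences-progression-none b n zero    z miss = refl
  occurrences-progression-none b n (suc d) z miss = cong₂ ℕ._+_
    (δ-∤ (miss 0 (s≤s z≤n) ∘ subst (λ w → + N ∣ w - + z) (sym (progression-head b n))))
    (occurrences-progression-none (b + + n) n d z (λ i i<d → miss (suc i) (s≤s i<d) ∘ subst (λ w → + N ∣ w - + z) (progression-step b n i)))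

  occurrences-progression-hit : ∀ b n d z i → i ℕ.< d → + N ∣ (b + + (n ℕ.* i)) - + z → 1 ℕ.≤ occurrences (progression b n d) z
  occurrences-progression-hit b n (suc d) z zero    _         N∣ =
    ℕP.≤-trans (ℕP.≤-reflexive (sym (δ-∣ (subst (λ w → + N ∣ w - + z) (progression-head b n) N∣)))) (ℕP.m≤m+n _ _)
  occurrences-progression-hit b n (suc d) z (suc i) (s≤s i<d) N∣ =
    ℕP.≤-trans (occurrences-progression-hit (b + + n) n d z i i<d (subst (λ w → + N ∣ w - + z) (sym (progression-step b n i)) N∣))
               (ℕP.m≤n+m _ (δ b z))

  -- Two hits at distance 0 < n·(i+1) < N would be congruent modulo N.
  occurrences-progression-≤1 : ∀ b n d z → 0 ℕ.< n → n ℕ.* d ℕ.≤ N → occurrences (progression b n d) z ℕ.≤ 1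
  occurrences-progression-≤1 b n zero    z 0<n _ = z≤n
  occurrences-progression-≤1 b n (suc d) z 0<n nd≤N with + N ∣? b - + z
  ... | no  _  = occurrences-progression-≤1 (b + + n) n d z 0<n (ℕP.≤-trans (ℕP.*-monoʳ-≤ n (ℕP.n≤1+n d)) nd≤N)
  ... | yes N∣ = s≤s (ℕP.≤-reflexive (occurrences-progression-none (b + + n) n d z no-other-hit))
    where
    no-other-hit : ∀ i → i ℕ.< d → ¬ (+ N ∣ ((b + + n) + + (n ℕ.* i)) - + z)
    no-other-hit i i<d N∣′ = ℕD.>⇒∤ {{ℕ.>-nonZero (ℕP.*-mono-< 0<n (s≤s (z≤n {i})))}}
                               (ℕP.<-≤-trans (ℕP.*-monoʳ-< n {{ℕ.>-nonZero 0<n}} (s≤s i<d)) nd≤N)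
                               (∣⇒∣ᵤ (subst (+ N ∣_) distance (∣m∣n⇒∣m-n N∣′ N∣)))
      where
      distance : (((b + + n) + + (n ℕ.* i)) - + z) - (b - + z) ≡ + (n ℕ.* suc i)
      distance = trans (cong (λ w → (w - + z) - (b - + z)) (progression-step b n i)) (cancel b (+ (n ℕ.* suc i)) (+ z))
        where cancel : ∀ b a z → ((b + a) - z) - (b - z) ≡ a
              cancel = solve-∀

  -- If z − b = t·n then z is hit at index t mod d.
  occurrences-progression-≥1 : ∀ b n d z → n ℕ.* d ≡ N → + n ∣ + z - b → 1 ℕ.≤ occurrences (progression b n d) z
  occurrences-progression-≥1 b n d z nd (divides t z-b≡t*n) = occurrences-progression-hit b n d z i (n%ℕd<d t d) N∣
    where
    instance
      d≢0 = factor≢0ʳ n d nd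
    i = t %ℕ d
    q = t /ℕ d
    N∣ : + N ∣ (b + + (n ℕ.* i)) - + z
    N∣ = divides (- q) (begin
      (b + + (n ℕ.* i)) - + z                    ≡⟨ cong (λ w → (b + w) - + z) (ℤP.pos-* n i) ⟩
      (b + + n * + i) - + z                      ≡⟨ cong (λ w → (b + + n * + i) - w) (split (+ z) b) ⟩
      (b + + n * + i) - ((+ z - b) + b)          ≡⟨ cong (λ w → (b + + n * + i) - (w + b)) (trans z-b≡t*n (cong (_* + n) (a≡a%ℕn+[a/ℕn]*n t d))) ⟩
      (b + + n * + i) - ((+ i + q * + d) * + n + b) ≡⟨ regroup b (+ n) (+ i) q (+ d) ⟩
      - q * (+ n * + d)                          ≡⟨ cong (λ w → - q * w) (trans (sym (ℤP.pos-* n d)) (cong +_ nd)) ⟩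
      - q * + N                                  ∎)
      where
      open ≡-Reasoning
      split : ∀ z b → z ≡ (z - b) + b
      split = solve-∀
      regroup : ∀ b n i q d → (b + n * i) - ((i + q * d) * n + b) ≡ - q * (n * d)
      regroup = solve-∀

  occurrences-progressions : ∀ {r} b n (d : Fin r → ℕ) z →
    occurrences (progressions b n d) z ≡ sum (map (λ s → occurrences (progression (b s) (n s) (d s)) z) (allFin r))
  occurrences-progressions {zero}  b n d z = refl
  occurrences-progressions {suc r} b n d z =
    trans (occurrences-++ (progression (b zero) (n zero) (d zero)) _ z)
          (trans (cong (occurrences (progression (b zero) (n zero) (d zero)) z ℕ.+_) (occurrences-progressions (b ∘ suc) (n ∘ suc) (d ∘ suc) z))
                 (sym (sum-map-allFin-suc (λ s → occurrences (progression (b s) (n s) (d s)) z))))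

  infix 4 _≈ᴱ_
  record _≈ᴱ_ (X X′ : Poly) : Set where
    constructor mk≈ᴱ
    field E*-≈ₚ : E *ₚ X ≈ₚ E *ₚ X′
  open _≈ᴱ_ public

  ≈ₚ⇒≈ᴱ : ∀ {X X′} → X ≈ₚ X′ → X ≈ᴱ X′
  ≈ₚ⇒≈ᴱ X≈X′ = mk≈ᴱ (*ₚ-congʳ E X≈X′)

  ≈ᴱ-refl : ∀ {X} → X ≈ᴱ X
  ≈ᴱ-refl = mk≈ᴱ ≈ₚ-refl

  ≈ᴱ-trans : ∀ {X X′ X″} → X ≈ᴱ X′ → X′ ≈ᴱ X″ → X ≈ᴱ X″
  ≈ᴱ-trans (mk≈ᴱ p) (mk≈ᴱ q) = mk≈ᴱ (≈ₚ-trans p q)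

  ≈ᴱ-*ₚ : ∀ {X X′ Z Z′} → X ≈ᴱ X′ → Z ≈ᴱ Z′ → X *ₚ Z ≈ᴱ X′ *ₚ Z′
  ≈ᴱ-*ₚ {X} {X′} {Z} {Z′} (mk≈ᴱ EX≈EX′) (mk≈ᴱ EZ≈EZ′) = mk≈ᴱ (begin
    E *ₚ (X *ₚ Z)      ≈⟨ ≈ₚ-reflexive (*ₚ-assoc E X Z) ⟨
    (E *ₚ X) *ₚ Z      ≈⟨ *ₚ-cong EX≈EX′ ≈ₚ-refl ⟩
    (E *ₚ X′) *ₚ Z     ≈⟨ ≈ₚ-reflexive (*ₚ-assoc E X′ Z) ⟩
    E *ₚ (X′ *ₚ Z)     ≈⟨ x∙yz≈y∙xz E X′ Z ⟩
    X′ *ₚ (E *ₚ Z)     ≈⟨ *ₚ-congʳ X′ EZ≈EZ′ ⟩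
    X′ *ₚ (E *ₚ Z′)    ≈⟨ x∙yz≈y∙xz X′ E Z′ ⟩
    E *ₚ (X′ *ₚ Z′)    ∎)
    where open import Relation.Binary.Reasoning.Setoid ≈ₚ-setoid

  ≈ᴱ-^ₚ : ∀ {X X′} → X ≈ᴱ X′ → ∀ m → X ^ₚ m ≈ᴱ X′ ^ₚ m
  ≈ᴱ-^ₚ X≈X′ zero    = mk≈ᴱ ≈ₚ-refl
  ≈ᴱ-^ₚ X≈X′ (suc m) = ≈ᴱ-*ₚ X≈X′ (≈ᴱ-^ₚ X≈X′ m)

  Π : Poly
  Π = ∏1-u^ multiset (λ _ → 1) N Y

  1-Y^N : Poly
  1-Y^N = 1-u^ 0ℤ Y^ N

  Π≈ᴱ1-Y^N : Π ≈ᴱ 1-Y^N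
  Π≈ᴱ1-Y^N = ≈ᴱ-trans (≈ₚ⇒≈ᴱ Π≈∏progression) (mk≈ᴱ (E-cyclotomic 0ℤ 1 N (ℕP.*-identityˡ N)))
    where
    once : ∀ z → z ℕ.< N → occurrences (progression 0ℤ 1 N) z ≡ 1
    once z _ = ℕP.≤-antisym (occurrences-progression-≤1 0ℤ 1 N z (s≤s z≤n) (ℕP.≤-reflexive (ℕP.*-identityˡ N)))
                            (occurrences-progression-≥1 0ℤ 1 N z (ℕP.*-identityˡ N) (divides (+ z - 0ℤ) (sym (ℤP.*-identityʳ _))))
    Π≈∏progression : Π ≈ₚ ∏1-u^ progression 0ℤ 1 N Y
    Π≈∏progression = ≈ₚ-trans (≈ₚ-reflexive (cong ∏1-u^_Y (multiset-cong N (λ z z<N → sym (once z z<N)))))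
                              (≈ₚ-sym (∏1-u^Y-normal-form (progression 0ℤ 1 N)))

  multiset-peel : ∀ k W → (∀ z → z ℕ.< N → k ℕ.≤ W z) → multiset W N ≡ multiset (λ z → k ℕ.+ (W z ∸ k)) N
  multiset-peel k W k≤W = multiset-cong N (λ z z<N → sym (ℕP.m+[n∸m]≡n (k≤W z z<N)))

  ∏1-u^Y-peel : ∀ k W → (∀ z → z ℕ.< N → k ℕ.≤ W z) → ∏1-u^ multiset W N Y ≈ₚ Π ^ₚ k *ₚ ∏1-u^ multiset (λ z → W z ∸ k) N Y
  ∏1-u^Y-peel k W k≤W = ≈ₚ-trans (≈ₚ-reflexive (cong ∏1-u^_Y (multiset-peel k W k≤W)))
    (≈ₚ-trans (∏1-u^Y-multiset-+ (λ _ → k) (λ z → W z ∸ k) N) (*ₚ-cong (∏1-u^Y-multiset-const k N) ≈ₚ-refl))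

  length-peel : ∀ k W → (∀ z → z ℕ.< N → k ℕ.≤ W z) → length (multiset W N) ≡ N ℕ.* k ℕ.+ length (multiset (λ z → W z ∸ k) N)
  length-peel k W k≤W = trans (cong length (multiset-peel k W k≤W))
    (trans (length-multiset-+ (λ _ → k) (λ z → W z ∸ k) N) (cong (ℕ._+ length (multiset (λ z → W z ∸ k) N)) (length-multiset-const k N)))

  factorise-cover : ∀ m Ls A →
    (∀ z → z ℕ.< N → suc m ℕ.≤ occurrences Ls z ℕ.+ occurrences A z) →
    (∀ z → z ℕ.< N → occurrences A z ℕ.≤ 1) →
    length Ls ℕ.< suc m ℕ.* N →
    Σ[ Rs ∈ List ℤ ] Σ[ Qs ∈ List ℤ ]
      (∏1-u^ Ls Y ≈ₚ Π ^ₚ m *ₚ ∏1-u^ Rs Y) × (∏1-u^ Rs Y *ₚ ∏1-u^ A Y ≈ₚ Π *ₚ ∏1-u^ Qs Y)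
      × length Rs ℕ.< N × length Qs ℕ.< length A
  factorise-cover m Ls A cover A≤1 Ls-short = multiset V N , multiset (λ z → U z ∸ 1) N , Ls≈ , Rs*A≈ , Rs-short , Qs-short
    where
    W = occurrences Ls
    V = λ z → W z ∸ m
    U = λ z → V z ℕ.+ occurrences A z
    m≤W : ∀ z → z ℕ.< N → m ℕ.≤ W z
    m≤W z z<N = ℕP.≤-pred (begin
      suc m                         ≤⟨ cover z z<N ⟩
      W z ℕ.+ occurrences A z       ≤⟨ ℕP.+-monoʳ-≤ (W z) (A≤1 z z<N) ⟩
      W z ℕ.+ 1                     ≡⟨ ℕP.+-comm (W z) 1 ⟩
      suc (W z)                     ∎)
      where open ℕP.≤-Reasoning
    1≤U : ∀ z → z ℕ.< N → 1 ℕ.≤ U z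
    1≤U z z<N = ℕP.+-cancelˡ-≤ m 1 (U z) (begin
      m ℕ.+ 1                       ≡⟨ ℕP.+-comm m 1 ⟩
      suc m                         ≤⟨ cover z z<N ⟩
      W z ℕ.+ occurrences A z       ≡⟨ cong (ℕ._+ occurrences A z) (ℕP.m+[n∸m]≡n (m≤W z z<N)) ⟨
      m ℕ.+ V z ℕ.+ occurrences A z ≡⟨ ℕP.+-assoc m (V z) _ ⟩
      m ℕ.+ U z                     ∎)
      where open ℕP.≤-Reasoning
    Ls≈ : ∏1-u^ Ls Y ≈ₚ Π ^ₚ m *ₚ ∏1-u^ multiset V N Y
    Ls≈ = ≈ₚ-trans (∏1-u^Y-normal-form Ls) (∏1-u^Y-peel m W m≤W)
    Rs*A≈ : ∏1-u^ multiset V N Y *ₚ ∏1-u^ A Y ≈ₚ Π *ₚ ∏1-u^ multiset (λ z → U z ∸ 1) N Y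
    Rs*A≈ = begin
      ∏1-u^ multiset V N Y *ₚ ∏1-u^ A Y                                ≈⟨ *ₚ-congʳ (∏1-u^ multiset V N Y) (∏1-u^Y-normal-form A) ⟩
      ∏1-u^ multiset V N Y *ₚ ∏1-u^ multiset (occurrences A) N Y       ≈⟨ ∏1-u^Y-multiset-+ V (occurrences A) N ⟨
      ∏1-u^ multiset U N Y                                             ≈⟨ ∏1-u^Y-peel 1 U 1≤U ⟩
      Π ^ₚ 1 *ₚ ∏1-u^ multiset (λ z → U z ∸ 1) N Y                     ≈⟨ *ₚ-cong (*ₚ-identityʳ Π) ≈ₚ-refl ⟩
      Π *ₚ ∏1-u^ multiset (λ z → U z ∸ 1) N Y                          ∎
      where open import Relation.Binary.Reasoning.Setoid ≈ₚ-setoid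
    Rs-short : length (multiset V N) ℕ.< N
    Rs-short = ℕP.+-cancelˡ-< (N ℕ.* m) _ N (begin-strict
      N ℕ.* m ℕ.+ length (multiset V N)    ≡⟨ length-peel m W m≤W ⟨
      length (multiset W N)                ≡⟨ length-multiset-occurrences Ls ⟩
      length Ls                            <⟨ Ls-short ⟩
      suc m ℕ.* N                          ≡⟨ trans (ℕP.+-comm N (m ℕ.* N)) (cong (ℕ._+ N) (ℕP.*-comm m N)) ⟩
      N ℕ.* m ℕ.+ N                        ∎)
      where open ℕP.≤-Reasoning
    Qs-short : length (multiset (λ z → U z ∸ 1) N) ℕ.< length A
    Qs-short = ℕP.+-cancelˡ-< (N ℕ.* 1) _ (length A) (begin-strict
      N ℕ.* 1 ℕ.+ length (multiset (λ z → U z ∸ 1) N)  ≡⟨ length-peel 1 U 1≤U ⟨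
      length (multiset U N)                             ≡⟨ length-multiset-+ V (occurrences A) N ⟩
      length (multiset V N) ℕ.+ length (multiset (occurrences A) N) ≡⟨ cong (length (multiset V N) ℕ.+_) (length-multiset-occurrences A) ⟩
      length (multiset V N) ℕ.+ length A                <⟨ ℕP.+-monoˡ-< (length A) Rs-short ⟩
      N ℕ.+ length A                                    ≡⟨ cong (ℕ._+ length A) (ℕP.*-identityʳ N) ⟨
      N ℕ.* 1 ℕ.+ length A                              ∎)
      where open ℕP.≤-Reasoning

  coeff-1-Y^N^m* : ∀ m X {D} → Deg≤ D X → D ℕ.< N → ∀ j {r} → r ℕ.< N → ∀ x →
                   coeff (1-Y^N ^ₚ m *ₚ X) (j ℕ.* N ℕ.+ r) x ≡ -1ℤ ℤ.^ j * + (m C j) * coeff X r x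
  coeff-1-Y^N^m* zero X X≤D D<N zero {r} r<N x = trans (cong (λ p → coeff p r x) (*ₚ-identityˡ X)) (sym (ℤP.*-identityˡ _))
  coeff-1-Y^N^m* zero X X≤D D<N (suc j) {r} r<N x =
    trans (cong (λ p → coeff p (suc j ℕ.* N ℕ.+ r) x) (*ₚ-identityˡ X))
          (trans (coeff-deg> X≤D x (ℕP.<-≤-trans D<N (ℕP.≤-trans (ℕP.m≤m+n N (j ℕ.* N)) (ℕP.m≤m+n _ r))))
                 (sym (cong (_* coeff X r x) (ℤP.*-zeroʳ (-1ℤ ℤ.^ suc j)))))
  coeff-1-Y^N^m* (suc m) X X≤D D<N zero {r} r<N x =
    trans (cong (λ p → coeff p r x) (*ₚ-assoc 1-Y^N (1-Y^N ^ₚ m) X))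
          (trans (coeff-1-u^Y^*-< 0ℤ N (1-Y^N ^ₚ m *ₚ X) x r<N) (coeff-1-Y^N^m* m X X≤D D<N zero r<N x))
  coeff-1-Y^N^m* (suc m) X X≤D D<N (suc j) {r} r<N x = begin
    coeff (1-Y^N ^ₚ suc m *ₚ X) e x                  ≡⟨ cong (λ p → coeff p e x) (*ₚ-assoc 1-Y^N (1-Y^N ^ₚ m) X) ⟩
    coeff (1-Y^N *ₚ Z) e x                           ≡⟨ coeff-1-u^Y^*-≥ 0ℤ N Z x (ℕP.≤-trans (ℕP.m≤m+n N (j ℕ.* N)) (ℕP.m≤m+n _ r)) ⟩
    coeff Z e x - coeff Z (e ∸ N) (x - 0ℤ)           ≡⟨ cong₂ (λ k y → coeff Z e x - coeff Z k y) e∸N (ℤP.+-identityʳ x) ⟩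
    coeff Z e x - coeff Z (j ℕ.* N ℕ.+ r) x          ≡⟨ cong₂ _-_ (coeff-1-Y^N^m* m X X≤D D<N (suc j) r<N x) (coeff-1-Y^N^m* m X X≤D D<N j r<N x) ⟩
    -1ℤ ℤ.^ suc j * + (m C suc j) * c - -1ℤ ℤ.^ j * + (m C j) * c ≡⟨ pascal (-1ℤ ℤ.^ j) (+ (m C suc j)) (+ (m C j)) c ⟩
    -1ℤ ℤ.^ suc j * (+ (m C j) + + (m C suc j)) * c  ≡⟨ cong (λ k → -1ℤ ℤ.^ suc j * k * c) pascal-ℤ ⟩
    -1ℤ ℤ.^ suc j * + (suc m C suc j) * c            ∎
    where
    open ≡-Reasoning
    e = suc j ℕ.* N ℕ.+ r
    Z = 1-Y^N ^ₚ m *ₚ X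
    c = coeff X r x
    e∸N : e ∸ N ≡ j ℕ.* N ℕ.+ r
    e∸N = trans (cong (_∸ N) (ℕP.+-assoc N (j ℕ.* N) r)) (ℕP.m+n∸m≡n N (j ℕ.* N ℕ.+ r))
    pascal : ∀ s a b c → -1ℤ * s * a * c - s * b * c ≡ -1ℤ * s * (b + a) * c
    pascal = solve-∀
    pascal-ℤ : + (m C j) + + (m C suc j) ≡ + (suc m C suc j)
    pascal-ℤ = trans (sym (ℤP.pos-+ (m C j) _)) (cong +_ (nCk+nC[k+1]≡[n+1]C[k+1] m j))

  -- Below degree N the right-hand side is Q, which vanishes from degree d on.
  coeff-recurrence : ∀ g d R Q {DQ} → Deg≤ DQ Q → DQ ℕ.< d → 1-u^ g Y^ d *ₚ R ≈ₚ 1-Y^N *ₚ Q →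
                     ∀ α → α ℕ.* d ℕ.< N → ∀ x → coeff R (α ℕ.* d) x ≡ coeff R 0 (x - + α * g)
  coeff-recurrence g d R Q Q≤DQ DQ<d BR≈PQ zero    αd<N x = cong (coeff R 0) (sym (ℤP.+-identityʳ x))
  coeff-recurrence g d R Q Q≤DQ DQ<d BR≈PQ (suc α) αd<N x = begin
    coeff R e x                                  ≡⟨ ℤP.i-j≡0⇒i≡j _ _ step ⟩
    coeff R (e ∸ d) (x - g)                      ≡⟨ cong (λ k → coeff R k (x - g)) (ℕP.m+n∸m≡n d (α ℕ.* d)) ⟩
    coeff R (α ℕ.* d) (x - g)                    ≡⟨ coeff-recurrence g d R Q Q≤DQ DQ<d BR≈PQ α (ℕP.≤-<-trans (ℕP.m≤n+m _ d) αd<N) (x - g) ⟩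
    coeff R 0 ((x - g) - + α * g)                ≡⟨ cong (coeff R 0) (regroup x g (+ α)) ⟩
    coeff R 0 (x - + suc α * g)                  ∎
    where
    open ≡-Reasoning
    e = suc α ℕ.* d
    d≤e : d ℕ.≤ e
    d≤e = ℕP.m≤m+n d (α ℕ.* d)
    regroup : ∀ x g a → (x - g) - a * g ≡ x - (1ℤ + a) * g
    regroup = solve-∀
    step : coeff R e x - coeff R (e ∸ d) (x - g) ≡ 0ℤ
    step = begin
      coeff R e x - coeff R (e ∸ d) (x - g)      ≡⟨ coeff-1-u^Y^*-≥ g d R x d≤e ⟨
      coeff (1-u^ g Y^ d *ₚ R) e x               ≡⟨ coeff-≡ BR≈PQ e x ⟩
      coeff (1-Y^N *ₚ Q) e x                     ≡⟨ coeff-1-u^Y^*-< 0ℤ N Q x αd<N ⟩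
      coeff Q e x                                ≡⟨ coeff-deg> Q≤DQ x (ℕP.<-≤-trans DQ<d d≤e) ⟩
      0ℤ                                         ∎

  ∣coeff-E∣≤1 : ∀ e y → ℤ.∣ coeff E e y ∣ ℕ.≤ 1
  ∣coeff-E∣≤1 zero    y = Peaked.bounded E-peaked y
  ∣coeff-E∣≤1 (suc e) y = subst (λ c → ℤ.∣ c ∣ ℕ.≤ 1) (sym (coeff-deg> Deg≤0-E y (s≤s z≤n))) z≤n

  ∣mulCoeff-E∣≤1 : ∀ t → ℤ.∣ coef t ∣ ℕ.≤ 1 → ∀ k x → ℤ.∣ mulCoeff t (coeff E) k x ∣ ℕ.≤ 1
  ∣mulCoeff-E∣≤1 t ∣c∣≤1 k x with deg t ℕ.≤? k
  ... | yes _ = subst (ℕ._≤ 1) (sym (ℤP.abs-* (coef t) _)) (ℕP.*-mono-≤ ∣c∣≤1 (∣coeff-E∣≤1 _ _))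
  ... | no  _ = z≤n

  mulCoeff-E-deg≢ : ∀ t {k} x → deg t ≢ k → mulCoeff t (coeff E) k x ≡ 0ℤ
  mulCoeff-E-deg≢ t {k} x deg≢k with deg t ℕ.≤? k
  ... | yes deg≤k = trans (cong (coef t *_) (coeff-deg> Deg≤0-E _ (ℕP.m<n⇒0<n∸m (ℕP.≤∧≢⇒< deg≤k deg≢k)))) (ℤP.*-zeroʳ (coef t))
  ... | no  _     = refl

  -- Each monomial of T of degree k contributes at most 1 to coeff (E·T) k x, the others nothing.
  ∣coeff-E*∣≤countDeg : ∀ T → All (λ t → ℤ.∣ coef t ∣ ℕ.≤ 1) T → ∀ k x → ℤ.∣ coeff (E *ₚ T) k x ∣ ℕ.≤ countDeg k T
  ∣coeff-E*∣≤countDeg T T≤1 k x =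
    subst (ℕ._≤ countDeg k T) (cong ℤ.∣_∣ (sym (trans (coeff-≡ (*ₚ-comm E T) k x) (coeff-*ₚ T E k x)))) (go T T≤1)
    where
    go : ∀ T → All (λ t → ℤ.∣ coef t ∣ ℕ.≤ 1) T → ℤ.∣ ∑ (λ t → mulCoeff t (coeff E) k x) T ∣ ℕ.≤ countDeg k T
    go []      []             = z≤n
    go (t ∷ T) (∣c∣≤1 ∷ T≤1) with deg t ℕ.≟ k
    ... | yes _    =
      ℕP.≤-trans (ℤP.∣i+j∣≤∣i∣+∣j∣ (mulCoeff t (coeff E) k x) rest) (ℕP.+-mono-≤ (∣mulCoeff-E∣≤1 t ∣c∣≤1 k x) (go T T≤1))
      where rest = ∑ (λ t → mulCoeff t (coeff E) k x) T
    ... | no deg≢k =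
      subst (ℕ._≤ countDeg k T) (cong ℤ.∣_∣ (sym (trans (cong (_+ rest) (mulCoeff-E-deg≢ t x deg≢k)) (ℤP.+-identityˡ rest)))) (go T T≤1)
      where rest = ∑ (λ t → mulCoeff t (coeff E) k x) T

  coeff-E*∏1-u^Y-0 : ∀ ys y → coeff (E *ₚ ∏1-u^ ys Y) 0 y ≡ coeff E 0 y
  coeff-E*∏1-u^Y-0 ys y = begin
    coeff (E *ₚ ∏1-u^ ys Y) 0 y   ≡⟨ coeff-*ₚ-deg0 Deg≤0-E (∏1-u^ ys Y) 0 y ⟩
    act E (coeff (∏1-u^ ys Y) 0) y ≡⟨ act-cong E (coeff-∏1-u^Y-0 ys) y ⟩
    act E (coeff 1ₚ 0) y          ≡⟨ coeff-*ₚ-deg0 Deg≤0-E 1ₚ 0 y ⟨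
    coeff (E *ₚ 1ₚ) 0 y           ≡⟨ coeff-≡ (*ₚ-identityʳ E) 0 y ⟩
    coeff E 0 y                   ∎
    where open ≡-Reasoning

  ∣-1^j*n∣ : ∀ j n → ℤ.∣ -1ℤ ℤ.^ j * + n * 1ℤ ∣ ≡ n
  ∣-1^j*n∣ zero    n = cong ℤ.∣_∣ (unit (+ n))
    where unit : ∀ n → 1ℤ * n * 1ℤ ≡ n
          unit = solve-∀
  ∣-1^j*n∣ (suc j) n = trans (cong ℤ.∣_∣ (negate (-1ℤ ℤ.^ j) (+ n))) (trans (ℤP.∣-i∣≡∣i∣ (-1ℤ ℤ.^ j * + n * 1ℤ)) (∣-1^j*n∣ j n))
    where negate : ∀ s n → -1ℤ * s * n * 1ℤ ≡ - (s * n * 1ℤ)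
          negate = solve-∀

  -- The coefficient of u^{αg}·Y^{jN+αd} in E·T equals ±C(m,j)·coeff E 0 0 = ±C(m,j).
  binomial-lower-bound : ∀ m j α g d T Rs Qs → All (λ t → ℤ.∣ coef t ∣ ℕ.≤ 1) T →
    T ≈ᴱ 1-Y^N ^ₚ m *ₚ ∏1-u^ Rs Y → ∏1-u^ Rs Y *ₚ 1-u^ g Y^ d ≈ᴱ 1-Y^N *ₚ ∏1-u^ Qs Y →
    length Rs ℕ.< N → length Qs ℕ.< d → α ℕ.* d ℕ.< N → m C j ℕ.≤ countDeg (j ℕ.* N ℕ.+ α ℕ.* d) T
  binomial-lower-bound m j α g d T Rs Qs T≤1 (mk≈ᴱ ET≈) (mk≈ᴱ ERB≈) Rs<N Qs<d αd<N =
    subst (ℕ._≤ countDeg k T) (∣-1^j*n∣ j (m C j))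
          (subst (λ c → ℤ.∣ c ∣ ℕ.≤ countDeg k T) value (∣coeff-E*∣≤countDeg T T≤1 k x₀))
    where
    k  = j ℕ.* N ℕ.+ α ℕ.* d
    x₀ = + α * g
    R′ = E *ₚ ∏1-u^ Rs Y
    Q′ = E *ₚ ∏1-u^ Qs Y
    B  = 1-u^ g Y^ d
    Deg≤-R′ : Deg≤ (0 ℕ.+ length Rs) R′
    Deg≤-R′ = Deg≤-*ₚ Deg≤0-E (Deg≤-∏1-u^Y Rs)
    Deg≤-Q′ : Deg≤ (0 ℕ.+ length Qs) Q′
    Deg≤-Q′ = Deg≤-*ₚ Deg≤0-E (Deg≤-∏1-u^Y Qs)
    ET≈P^mR′ : E *ₚ T ≈ₚ 1-Y^N ^ₚ m *ₚ R′
    ET≈P^mR′ = ≈ₚ-trans ET≈ (x∙yz≈y∙xz E (1-Y^N ^ₚ m) (∏1-u^ Rs Y))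
    BR′≈PQ′ : B *ₚ R′ ≈ₚ 1-Y^N *ₚ Q′
    BR′≈PQ′ = begin
      B *ₚ (E *ₚ ∏1-u^ Rs Y)         ≈⟨ x∙yz≈y∙xz B E (∏1-u^ Rs Y) ⟩
      E *ₚ (B *ₚ ∏1-u^ Rs Y)         ≈⟨ *ₚ-congʳ E (*ₚ-comm B (∏1-u^ Rs Y)) ⟩
      E *ₚ (∏1-u^ Rs Y *ₚ B)         ≈⟨ ERB≈ ⟩
      E *ₚ (1-Y^N *ₚ ∏1-u^ Qs Y)     ≈⟨ x∙yz≈y∙xz E 1-Y^N (∏1-u^ Qs Y) ⟩
      1-Y^N *ₚ (E *ₚ ∏1-u^ Qs Y)     ∎
      where open import Relation.Binary.Reasoning.Setoid ≈ₚ-setoid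
    ±C = -1ℤ ℤ.^ j * + (m C j)
    value : coeff (E *ₚ T) k x₀ ≡ ±C * 1ℤ
    value = begin
      coeff (E *ₚ T) k x₀              ≡⟨ coeff-≡ ET≈P^mR′ k x₀ ⟩
      coeff (1-Y^N ^ₚ m *ₚ R′) k x₀    ≡⟨ coeff-1-Y^N^m* m R′ Deg≤-R′ Rs<N j αd<N x₀ ⟩
      ±C * coeff R′ (α ℕ.* d) x₀       ≡⟨ cong (±C *_) (coeff-recurrence g d R′ Q′ Deg≤-Q′ Qs<d BR′≈PQ′ α αd<N x₀) ⟩
      ±C * coeff R′ 0 (x₀ - x₀)        ≡⟨ cong (λ y → ±C * coeff R′ 0 y) (ℤP.+-inverseʳ x₀) ⟩
      ±C * coeff R′ 0 0ℤ               ≡⟨ cong (±C *_) (trans (coeff-E*∏1-u^Y-0 Rs 0ℤ) (Peaked.at-0 E-peaked)) ⟩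
      ±C * 1ℤ                          ∎
      where open ≡-Reasoning

  ∏1-u^Y^≈ᴱ∏progressions : ∀ {r} b n (d : Fin r → ℕ) → (∀ s → n s ℕ.* d s ≡ N) →
                           ∏1-u^Y^ (λ s → b s * + d s) d ≈ᴱ ∏1-u^ progressions b n d Y
  ∏1-u^Y^≈ᴱ∏progressions {zero}  b n d n*d≡N = mk≈ᴱ ≈ₚ-refl
  ∏1-u^Y^≈ᴱ∏progressions {suc r} b n d n*d≡N =
    ≈ᴱ-trans (≈ᴱ-*ₚ (mk≈ᴱ (≈ₚ-sym (E-cyclotomic (b zero) (n zero) (d zero) (n*d≡N zero))))
                    (∏1-u^Y^≈ᴱ∏progressions (b ∘ suc) (n ∘ suc) (d ∘ suc) (n*d≡N ∘ suc)))
             (≈ₚ⇒≈ᴱ (≈ₚ-sym (∏1-u^Y-++ (progression (b zero) (n zero) (d zero)) (progressions (b ∘ suc) (n ∘ suc) (d ∘ suc)))))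

module Fractions (N′ : ℕ) where

  N : ℕ
  N = suc N′

  infix 8 _/N
  _/N : ℕ → ℚᵘ
  a /N = mkℚᵘ (+ a) N′

  /N-+ : ∀ a b → a /N ℚᵘ.+ b /N ≃ (a ℕ.+ b) /N
  /N-+ a b = *≡* (begin
    (+ a * + N + + b * + N) * + N ≡⟨ regroup (+ a) (+ b) (+ N) ⟩
    (+ a + + b) * (+ N * + N)     ≡⟨ cong₂ _*_ (ℤP.pos-+ a b) (ℤP.pos-* N N) ⟨
    + (a ℕ.+ b) * + (N ℕ.* N)     ∎)
    where
    open ≡-Reasoning
    regroup : ∀ a b n → (a * n + b * n) * n ≡ (a + b) * (n * n)
    regroup = solve-∀

  /N-injective : ∀ {a b} → a /N ≃ b /N → a ≡ b
  /N-injective {a} {b} (*≡* a*N≡b*N) = ℤP.+-injective (ℤP.*-cancelʳ-≡ (+ a) (+ b) (+ N) a*N≡b*N)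

  toℚᵘ-/ : ∀ α n .{{_ : NonZero n}} d → n ℕ.* d ≡ N → toℚᵘ ((+ α) ℚ./ n) ≃ (α ℕ.* d) /N
  toℚᵘ-/ α n@(suc n′) d n*d≡N = ℚᵘP.≃-trans (ℚP.toℚᵘ-fromℚᵘ (mkℚᵘ (+ α) n′)) (*≡* (begin
    + α * + N                ≡⟨ cong (λ k → + α * + k) (sym n*d≡N) ⟩
    + α * + (n ℕ.* d)        ≡⟨ cong (+ α *_) (ℤP.pos-* n d) ⟩
    + α * (+ n * + d)        ≡⟨ regroup (+ α) (+ n) (+ d) ⟩
    (+ α * + d) * + n        ≡⟨ cong (_* + n) (ℤP.pos-* α d) ⟨
    + (α ℕ.* d) * + n        ∎))
    where
    open ≡-Reasoning
    regroup : ∀ a n d → a * (n * d) ≡ (a * d) * n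
    regroup = solve-∀

  toℚᵘ-recip : ∀ n (nz : NonZero n) d → n ℕ.* d ≡ N → toℚᵘ (recip n nz) ≃ d /N
  toℚᵘ-recip n nz d n*d≡N = ℚᵘP.≃-trans (toℚᵘ-/ 1 n {{nz}} d n*d≡N) (ℚᵘP.≃-reflexive (cong _/N (ℕP.*-identityˡ d)))

  toℚᵘ-sumℚ : ∀ {A : Set} (h : A → ℚ) (D : A → ℕ) → (∀ x → toℚᵘ (h x) ≃ D x /N) →
              ∀ xs → toℚᵘ (sumℚ (map h xs)) ≃ sum (map D xs) /N
  toℚᵘ-sumℚ h D h≃D []       = *≡* refl
  toℚᵘ-sumℚ h D h≃D (x ∷ xs) = ℚᵘP.≃-trans (ℚP.toℚᵘ-homo-+ (h x) (sumℚ (map h xs)))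
    (ℚᵘP.≃-trans (ℚᵘP.+-cong (h≃D x) (toℚᵘ-sumℚ h D h≃D xs)) (/N-+ (D x) (sum (map D xs))))

  floor-bound : ∀ p D → toℚᵘ p ≃ D /N → ∀ m → + m ≡ ℚ.floor p → D ℕ.< suc m ℕ.* N
  floor-bound (ℚ.mkℚ num den-1 _) D (*≡* num*N≡D*den) m m≡⌊p⌋ =
    ℤP.drop‿+<+ (ℤP.*-cancelʳ-<-nonNeg (+ den) (subst₂ ℤ._<_ num*N≡D*den rhs (ℤP.*-monoʳ-<-pos (+ N) num<[1+m]*den)))
    where
    den = suc den-1
    num<[1+m]*den : num ℤ.< (1ℤ + + m) * + den
    num<[1+m]*den = subst (λ q → num ℤ.< ℤ.suc q * + den) (trans (sym (div-pos-is-/ℕ num den)) (sym m≡⌊p⌋)) (n<s[n/ℕd]*d num den)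
    rhs : ((1ℤ + + m) * + den) * + N ≡ + (suc m ℕ.* N) * + den
    rhs = trans (swap (+ m) (+ den) (+ N)) (cong (_* + den) (sym (ℤP.pos-* (suc m) N)))
      where swap : ∀ m d n → ((1ℤ + m) * d) * n ≡ ((1ℤ + m) * n) * d
            swap = solve-∀

module CoveringToSubsetSums (k : ℕ) (a : Fin (suc k) → ℤ) (n : Fin (suc k) → ℕ) (nz : ∀ s → NonZero (n s))
                            (N′ : ℕ) (d : Fin (suc k) → ℕ) (n*d≡N : ∀ s → n s ℕ.* d s ≡ suc N′) where

  open Fractions N′
  open GroupRingPolynomials N
  open Cyclotomic N
  open SubsetExpansion N

  g : Fin k → ℤ
  g s = a (suc s) * + d (suc s)

  T : Poly
  T = map (subsetMonomial g (d ∘ suc)) (allSubsets k)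

  Ls : List ℤ
  Ls = progressions (a ∘ suc) (n ∘ suc) (d ∘ suc)

  A₀ : List ℤ
  A₀ = progression (a zero) (n zero) (d zero)

  T≈ᴱ∏Ls : T ≈ᴱ ∏1-u^ Ls Y
  T≈ᴱ∏Ls = ≈ᴱ-trans (≈ₚ⇒≈ᴱ (≈ₚ-sym (∏1-u^Y^-expansion g (d ∘ suc))))
                    (∏1-u^Y^≈ᴱ∏progressions (a ∘ suc) (n ∘ suc) (d ∘ suc) (n*d≡N ∘ suc))

  T-coefficients : All (λ t → ℤ.∣ coef t ∣ ℕ.≤ 1) T
  T-coefficients = AllP.map⁺ (All.universal (λ I → ℕP.≤-reflexive (∣coef-subsetMonomial∣ g (d ∘ suc) I)) (allSubsets k))

  covered-residues : ∀ {m} → (∀ x → coverCount a n x ℕ.> m) → ∀ z → z ℕ.< N → suc m ℕ.≤ occurrences Ls z ℕ.+ occurrences A₀ z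
  covered-residues {m} cover z z<N = begin
    suc m                                              ≤⟨ cover (+ z) ⟩
    coverCount a n (+ z)                               ≤⟨ count≤sum (λ s → + n s ∣? (+ z - a s)) F
                                                            (λ s → occurrences-progression-≥1 (a s) (n s) (d s) z (n*d≡N s)) (allFin (suc k)) ⟩
    sum (map F (allFin (suc k)))                       ≡⟨ sum-map-allFin-suc F ⟩
    occurrences A₀ z ℕ.+ sum (map (F ∘ suc) (allFin k)) ≡⟨ cong (occurrences A₀ z ℕ.+_) (occurrences-progressions (a ∘ suc) (n ∘ suc) (d ∘ suc) z) ⟨
    occurrences A₀ z ℕ.+ occurrences Ls z              ≡⟨ ℕP.+-comm (occurrences A₀ z) _ ⟩
    occurrences Ls z ℕ.+ occurrences A₀ z              ∎
    where
    open ℕP.≤-Reasoning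
    F = λ s → occurrences (progression (a s) (n s) (d s)) z

  A₀-at-most-once : ∀ z → occurrences A₀ z ℕ.≤ 1
  A₀-at-most-once z = occurrences-progression-≤1 (a zero) (n zero) (d zero) z (ℕ.>-nonZero⁻¹ (n zero) {{nz zero}}) (ℕP.≤-reflexive (n*d≡N zero))

  Ls-short : ∀ {m} → + m ≡ ℚ.floor (totalRecip (n ∘ suc) (nz ∘ suc)) → length Ls ℕ.< suc m ℕ.* N
  Ls-short {m} m≡⌊∑⌋ = subst (ℕ._< suc m ℕ.* N) (sym (length-progressions (a ∘ suc) (n ∘ suc) (d ∘ suc)))
    (floor-bound (totalRecip (n ∘ suc) (nz ∘ suc)) _ (toℚᵘ-∑recip (allFin k)) m m≡⌊∑⌋)
    where
    toℚᵘ-∑recip : ∀ xs → toℚᵘ (sumℚ (map (λ s → recip (n (suc s)) (nz (suc s))) xs)) ≃ sum (map (d ∘ suc) xs) /N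
    toℚᵘ-∑recip = toℚᵘ-sumℚ _ (d ∘ suc) (λ s → toℚᵘ-recip (n (suc s)) (nz (suc s)) (d (suc s)) (n*d≡N (suc s)))

  module _ (α : ℕ) where

    target : ℚ
    target = ((+ α) ℚ./ n zero) {{nz zero}}

    toℚᵘ-recipSum : ∀ I → toℚᵘ (recipSum (n ∘ suc) (nz ∘ suc) I) ≃ deg (subsetMonomial g (d ∘ suc) I) /N
    toℚᵘ-recipSum I = ℚᵘP.≃-trans
      (toℚᵘ-sumℚ _ (d ∘ suc) (λ s → toℚᵘ-recip (n (suc s)) (nz (suc s)) (d (suc s)) (n*d≡N (suc s))) (filter (_∈? I) (allFin k)))
      (ℚᵘP.≃-reflexive (cong _/N (sym (deg-subsetMonomial g (d ∘ suc) I))))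

    toℚᵘ-target : toℚᵘ target ≃ (α ℕ.* d zero) /N
    toℚᵘ-target = toℚᵘ-/ α (n zero) {{nz zero}} (d zero) (n*d≡N zero)

    deg⇒recipSum : ∀ I → deg (subsetMonomial g (d ∘ suc) I) ≡ α ℕ.* d zero → recipSum (n ∘ suc) (nz ∘ suc) I ≡ target
    deg⇒recipSum I deg≡ = ℚP.toℚᵘ-injective
      (ℚᵘP.≃-trans (toℚᵘ-recipSum I) (ℚᵘP.≃-trans (ℚᵘP.≃-reflexive (cong _/N deg≡)) (ℚᵘP.≃-sym toℚᵘ-target)))

    recipSum⇒deg : ∀ I → recipSum (n ∘ suc) (nz ∘ suc) I ≡ target → deg (subsetMonomial g (d ∘ suc) I) ≡ α ℕ.* d zero
    recipSum⇒deg I sum≡ = /N-injective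
      (ℚᵘP.≃-trans (ℚᵘP.≃-sym (toℚᵘ-recipSum I)) (ℚᵘP.≃-trans (ℚP.toℚᵘ-cong sum≡) toℚᵘ-target))

    countDeg-T : countDeg (α ℕ.* d zero) T ≡ countSubsets k (λ I → recipSum (n ∘ suc) (nz ∘ suc) I ≟ target)
    countDeg-T = countDeg-map (subsetMonomial g (d ∘ suc)) (α ℕ.* d zero) (λ I → recipSum (n ∘ suc) (nz ∘ suc) I ≟ target)
                              deg⇒recipSum recipSum⇒deg (allSubsets k)

  subset-count-bound : ∀ m → + m ≡ ℚ.floor (totalRecip (n ∘ suc) (nz ∘ suc)) → (∀ x → coverCount a n x ℕ.> m) → ∀ α →
    m C ((α / n zero) {{nz zero}}) ℕ.≤ countSubsets k (λ I → recipSum (n ∘ suc) (nz ∘ suc) I ≟ target α)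
  subset-count-bound m m≡⌊∑⌋ cover α
    with factorise-cover m Ls A₀ (covered-residues cover) (λ z _ → A₀-at-most-once z) (Ls-short m≡⌊∑⌋)
  ... | Rs , Qs , ∏Ls≈ , ∏Rs*∏A₀≈ , Rs<N , Qs<A₀ =
    subst (m C j ℕ.≤_) (trans (cong (λ e → countDeg e T) j*N+r*d₀≡α*d₀) (countDeg-T α))
      (binomial-lower-bound m j r (a zero * + d zero) (d zero) T Rs Qs T-coefficients T≈ ∏Rs*B≈ Rs<N Qs<d₀ r*d₀<N)
    where
    instance _ = nz zero
    j = α / n zero
    r = α % n zero
    T≈ : T ≈ᴱ 1-Y^N ^ₚ m *ₚ ∏1-u^ Rs Y
    T≈ = ≈ᴱ-trans T≈ᴱ∏Ls (≈ᴱ-trans (≈ₚ⇒≈ᴱ ∏Ls≈) (≈ᴱ-*ₚ (≈ᴱ-^ₚ Π≈ᴱ1-Y^N m) ≈ᴱ-refl))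
    ∏Rs*B≈ : ∏1-u^ Rs Y *ₚ 1-u^ (a zero * + d zero) Y^ d zero ≈ᴱ 1-Y^N *ₚ ∏1-u^ Qs Y
    ∏Rs*B≈ = ≈ᴱ-trans (≈ᴱ-*ₚ (≈ᴱ-refl {∏1-u^ Rs Y}) (mk≈ᴱ (≈ₚ-sym (E-cyclotomic (a zero) (n zero) (d zero) (n*d≡N zero)))))
               (≈ᴱ-trans (≈ₚ⇒≈ᴱ ∏Rs*∏A₀≈) (≈ᴱ-*ₚ Π≈ᴱ1-Y^N ≈ᴱ-refl))
    Qs<d₀ : length Qs ℕ.< d zero
    Qs<d₀ = subst (length Qs ℕ.<_) (length-progression (a zero) (n zero) (d zero)) Qs<A₀
    r*d₀<N : r ℕ.* d zero ℕ.< N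
    r*d₀<N = subst (r ℕ.* d zero ℕ.<_) (n*d≡N zero) (ℕP.*-monoˡ-< (d zero) {{factor≢0ʳ (n zero) (d zero) (n*d≡N zero)}} (ℕDM.m%n<n α (n zero)))
    j*N+r*d₀≡α*d₀ : j ℕ.* N ℕ.+ r ℕ.* d zero ≡ α ℕ.* d zero
    j*N+r*d₀≡α*d₀ = begin
      j ℕ.* N ℕ.+ r ℕ.* d zero                   ≡⟨ cong (λ M → j ℕ.* M ℕ.+ r ℕ.* d zero) (n*d≡N zero) ⟨
      j ℕ.* (n zero ℕ.* d zero) ℕ.+ r ℕ.* d zero ≡⟨ regroup j (n zero) (d zero) r ⟩
      (r ℕ.+ j ℕ.* n zero) ℕ.* d zero            ≡⟨ cong (ℕ._* d zero) (ℕDM.m≡m%n+[m/n]*n α (n zero)) ⟨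
      α ℕ.* d zero                               ∎
      where
      open ≡-Reasoning
      regroup : ∀ j n d r → j ℕ.* (n ℕ.* d) ℕ.+ r ℕ.* d ≡ (r ℕ.+ j ℕ.* n) ℕ.* d
      regroup = ℕSolver.solve-∀

covering⇒subset-sums :
  (k : ℕ) → 1 ≤ k →
  (a : Fin (suc k) → ℤ) (n : Fin (suc k) → ℕ) (nz : (s : Fin (suc k)) → NonZero (n s)) →
  (m : ℕ) → + m ≡ floor (totalRecip (λ s → n (suc s)) (λ s → nz (suc s))) →
  ((x : ℤ) → coverCount a n x > m) →
  (α : ℕ) →
    countSubsets k (λ I → recipSum (λ s → n (suc s)) (λ s → nz (suc s)) I ≟ ((+ α) ℚ./ n zero) {{nz zero}})
      ≥ m C ((α / n zero) {{nz zero}})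
covering⇒subset-sums k _ a n nz =
  CoveringToSubsetSums.subset-count-bound k a n nz (ℕ.pred N) d (λ s → trans (sym (ℕD.m∣n⇒n≡m*quotient (n∣N s))) (sym (ℕP.suc-pred N)))
  where
  N = product (map n (allFin (suc k)))
  instance
    N≢0 : NonZero N
    N≢0 = product≢0 (AllP.map⁺ (All.universal nz (allFin (suc k))))
  n∣N : ∀ s → n s ℕD.∣ N
  n∣N s = ∈⇒∣product (∈-map⁺ n (∈-allFin s))
  d : Fin (suc k) → ℕ
  d s = ℕD.quotient (n∣N s)

-- Adding the class 0 (mod 1) raises the covering multiplicity to M + 1.
exact-covering⇒integer-subset-sums :
  (k : ℕ) → 1 ≤ k →
  (a : Fin k → ℤ) (n : Fin k → ℕ) (nz : (s : Fin k) → NonZero (n s)) →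
  (M : ℕ) → + M ≡ floor (totalRecip n nz) →
  ((x : ℤ) → coverCount a n x ≥ M) → ∃ (λ x → coverCount a n x ≡ M) →
  (j : ℕ) →
    countSubsets k (λ I → recipSum n nz I ≟ ((+ j) ℚ./ 1)) ≥ M C j
exact-covering⇒integer-subset-sums k 1≤k a n nz M M≡⌊∑⌋ cover _ j =
  subst (λ i → M C i ℕ.≤ countSubsets k (λ I → recipSum n nz I ≟ ((+ j) ℚ./ 1))) (ℕDM.n/1≡n j)
        (covering⇒subset-sums k 1≤k a′ n′ nz′ M M≡⌊∑⌋ (λ x → subst (M ℕ.<_) (sym (coverCount-extended x)) (s≤s (cover x))) j)
  where
  a′ : Fin (suc k) → ℤ
  a′ zero    = 0ℤ
  a′ (suc s) = a s
  n′ : Fin (suc k) → ℕ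
  n′ zero    = 1
  n′ (suc s) = n s
  nz′ : (s : Fin (suc k)) → NonZero (n′ s)
  nz′ zero    = _
  nz′ (suc s) = nz s
  coverCount-extended : ∀ x → coverCount a′ n′ x ≡ suc (coverCount a n x)
  coverCount-extended x = begin
    length (filter P? (zero ∷ tabulate suc))               ≡⟨ cong length (ListP.filter-accept P? {zero} {tabulate suc} 1∣x-0) ⟩
    suc (length (filter P? (tabulate suc)))                ≡⟨ cong (suc ∘ length ∘ filter P?) (ListP.map-tabulate (λ i → i) fsuc) ⟨
    suc (length (filter P? (map fsuc (allFin k))))         ≡⟨ cong (suc ∘ length) (filter-map P? fsuc (allFin k)) ⟩
    suc (length (map fsuc (filter (P? ∘ fsuc) (allFin k)))) ≡⟨ cong suc (ListP.length-map fsuc (filter (P? ∘ fsuc) (allFin k))) ⟩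
    suc (coverCount a n x)                                 ∎
    where
    open ≡-Reasoning
    P? = λ s → (+ n′ s) ∣? (x - a′ s)
    fsuc : Fin k → Fin (suc k)
    fsuc = suc
    1∣x-0 : + 1 ∣ x - 0ℤ
    1∣x-0 = divides (x - 0ℤ) (sym (ℤP.*-identityʳ _))

corollary1p1 :
  ((k : ℕ) → 1 ≤ k →
    (a : Fin (suc k) → ℤ) (n : Fin (suc k) → ℕ) (nz : (s : Fin (suc k)) → NonZero (n s)) →
    (m : ℕ) → + m ≡ floor (totalRecip (λ s → n (suc s)) (λ s → nz (suc s))) →
    ((x : ℤ) → coverCount a n x > m) →
    (α : ℕ) →
      countSubsets k (λ I → recipSum (λ s → n (suc s)) (λ s → nz (suc s)) I
                              ≟ ((+ α) ℚ./ n zero) {{nz zero}})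
        ≥ m C ((α / n zero) {{nz zero}}))
  ×
  ((k : ℕ) → 1 ≤ k →
    (a : Fin k → ℤ) (n : Fin k → ℕ) (nz : (s : Fin k) → NonZero (n s)) →
    (M : ℕ) → + M ≡ floor (totalRecip n nz) →
    ((x : ℤ) → coverCount a n x ≥ M) → ∃ (λ x → coverCount a n x ≡ M) →
    (j : ℕ) →
      countSubsets k (λ I → recipSum n nz I ≟ ((+ j) ℚ./ 1)) ≥ M C j)
corollary1p1 = covering⇒subset-sums , exact-covering⇒integer-subset-sums
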